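{- The statistic $\operatorname{cdes}$ is constant on the double cosets $C\backslash W/C$. That is, for all $w\in W$ and $c_1,c_2\in C$, $\operatorname{cdes}(c_1wc_2)=\operatorname{cdes}(w)$.
   Context: Root system data. - $\Phi$ is an irreducible crystallographic root system in a real Euclidean space $V$ of dimension $r$, with simple roots $\alpha_1,\dots,\alpha_r$ and positive roots $\Phi^+$. Write $\alpha<0$ if $-\alpha\in\Phi^+$. - $W$ is the Weyl group. - $\Lambda^\vee=\{\lambda:(\lambda,\alpha)\in\mathbb{Z}\ \forall\alpha\in\Phi\}$ is the coweight lattice. - $\omega_i$ are the fundamental coweights, $(\omega_i,\alpha_j)=\delta_{ij}$, and $\rho=\sum\omega_i$. - $\theta$ is the highest root; set $\alpha_0=-\theta$, $a_0=1$, $a_i=(\omega_i,\theta)$, and $h^\vee=\sum_{i=0}^ra_i$. Definitions. - $C=\{w\in W:w(\rho)-\rho\in h^\vee\Lambda^\vee\}$, a subgroup of $W$. - For $w\in W$ and $0\le i\le r$, $d_i(w)=1$ if $w(\alpha_i)<0$ and $0$ otherwise. - $\operatorname{cdes}(w)=\sum_{i=0}^ra_id_i(w)$. -}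

module Defs where

open import Data.Nat as ℕ using (ℕ; zero; suc)
open import Data.Integer as ℤ using (ℤ; +_; -_; _+_; _-_; _*_; _≤_; _<_; 0ℤ; 1ℤ; _≤?_)
open import Data.Integer.Divisibility using (_∣_)
open import Data.Fin as Fin using (Fin; zero; suc)
open import Data.Fin.Properties using (all?)
open import Data.List using (List; []; _∷_)
open import Data.Bool using (Bool; true; false; if_then_else_)
open import Data.Product using (Σ; ∃; ∃₂; _×_; _,_)
open import Relation.Binary.PropositionalEquality using (_≡_; _≢_)
open import Relation.Nullary.Decidable using (⌊_⌋)

-- A vector β : Vecℤ r denotes either
--  * an element of the root lattice, β = Σ_k β k · α_k  (simple-root coordinates), or
--  * an element of the coweight lattice Λ^∨, λ = Σ_k λ k · ω_k (fundamental-coweight coordinates).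
Vecℤ : ℕ → Set
Vecℤ r = Fin r → ℤ

Matrix : ℕ → Set
Matrix r = Fin r → Fin r → ℤ

sumℤ : ∀ {n} → (Fin n → ℤ) → ℤ
sumℤ {zero}  f = 0ℤ
sumℤ {suc n} f = f zero + sumℤ (λ i → f (suc i))

unit : ∀ {r} → Fin r → Vecℤ r
unit i k = if ⌊ i Fin.≟ k ⌋ then 1ℤ else 0ℤ

negV : ∀ {r} → Vecℤ r → Vecℤ r
negV β k = - β k

-- Cartan matrix convention (Kac): A i j = ⟨α_i^∨ , α_j⟩ = 2 (α_i , α_j) / (α_i , α_i).
-- The conditions below characterise exactly the Cartan matrices of irreducible
-- (finite, crystallographic) root systems with respect to a base α_1 … α_r.
record IsIrreducibleCartan {r : ℕ} (A : Matrix r) : Set where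
  field
    diag      : ∀ i → A i i ≡ + 2
    offdiag   : ∀ i j → i ≢ j → A i j ≤ 0ℤ
    -- symmetrizer d i = (α_i , α_i) (positive integers after rescaling)
    d         : Fin r → ℕ
    d-pos     : ∀ i → 0 ℕ.< d i
    symm      : ∀ i j → + d i * A i j ≡ + d j * A j i
    -- the Gram matrix (α_i , α_j) ∝ d i * A i j is positive definite
    posdef    : ∀ (x : Vecℤ r) → (∃ λ i → x i ≢ 0ℤ) →
                0ℤ < sumℤ (λ i → sumℤ (λ j → x i * (+ d i * A i j) * x j))
    -- irreducibility: the Dynkin diagram is connected
    connected : ∀ (S : Fin r → Bool) → (∃ λ i → S i ≡ true) → (∃ λ j → S j ≡ false) →
                ∃₂ λ i j → S i ≡ true × S j ≡ false × A i j ≢ 0ℤ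

module _ {r : ℕ} (A : Matrix r) where

  -- simple reflection s_i on V, in simple-root coordinates:
  -- s_i(β) = β - ⟨α_i^∨ , β⟩ α_i ,  ⟨α_i^∨ , β⟩ = Σ_j A i j * β j
  sRoot : Fin r → Vecℤ r → Vecℤ r
  sRoot i β k = if ⌊ i Fin.≟ k ⌋ then β k - sumℤ (λ j → A i j * β j) else β k

  -- the same reflection s_i on coweights, in fundamental-coweight coordinates:
  -- s_i(λ) = λ - (λ , α_i) α_i^∨ ,  (λ , α_i) = λ i ,  α_i^∨ = Σ_k A i k ω_k
  sCoweight : Fin r → Vecℤ r → Vecℤ r
  sCoweight i λ' k = λ' k - λ' i * A i k

  -- Elements of the Weyl group W are represented by words in the simple reflections;
  -- the word i₁ ∷ i₂ ∷ … ∷ iₖ ∷ [] stands for s_{i₁} s_{i₂} ⋯ s_{iₖ}, so the group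
  -- product is list concatenation _++_.
  actRoot : List (Fin r) → Vecℤ r → Vecℤ r
  actRoot []      β = β
  actRoot (i ∷ w) β = sRoot i (actRoot w β)

  actCoweight : List (Fin r) → Vecℤ r → Vecℤ r
  actCoweight []      λ' = λ'
  actCoweight (i ∷ w) λ' = sCoweight i (actCoweight w λ')

  IsRoot : Vecℤ r → Set
  IsRoot β = ∃₂ λ (w : List (Fin r)) (i : Fin r) → ∀ k → actRoot w (unit i) k ≡ β k

  IsPositiveRoot : Vecℤ r → Set
  IsPositiveRoot β = IsRoot β × (∀ k → 0ℤ ≤ β k)

  IsHighestRoot : Vecℤ r → Set
  IsHighestRoot θ = IsRoot θ × (∀ β → IsRoot β → ∀ k → β k ≤ θ k)

  module _ (θ : Vecℤ r) where

    -- a_i = (ω_i , θ) = i-th simple-root coordinate of θ ;  a_0 = 1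
    -- h^∨ = a_0 + Σ_{i≥1} a_i
    hdual : ℤ
    hdual = 1ℤ + sumℤ θ

    -- ρ = Σ ω_i
    ρ : Vecℤ r
    ρ _ = 1ℤ

    InC : List (Fin r) → Set
    InC w = ∀ k → hdual ∣ (actCoweight w ρ k - ρ k)

    -- indicator of w(α) < 0 for a root α.  Since w(α) is itself a root, -w(α) ∈ Φ⁺
    -- holds iff all simple-root coordinates of w(α) are ≤ 0.
    negInd : List (Fin r) → Vecℤ r → ℤ
    negInd w α = if ⌊ all? (λ k → actRoot w α k ≤? 0ℤ) ⌋ then 1ℤ else 0ℤ

    d₀ : List (Fin r) → ℤ
    d₀ w = negInd w (negV θ)

    dᵢ : List (Fin r) → Fin r → ℤ
    dᵢ w i = negInd w (unit i)

    cdes : List (Fin r) → ℤ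
    cdes w = d₀ w + sumℤ (λ i → θ i * dᵢ w i)

{-# OPTIONS --safe #-}
module Submission where

-- Write h = h^∨ = 1 + height θ.  For c ∈ C we have c ρ = ρ + h λ for a coweight λ, and since the
-- pairing is W-invariant, height (c γ) = height γ - h ⟨λ , c γ⟩.  Every root is positive or
-- negative (Tits' argument: reduce to the rank-two parabolic generated by two simple reflections,
-- a finite dihedral group because the Cartan matrix is positive definite), and roots have
-- 0 < |height| < h; so the sign of a root is read off from its height modulo h.  Hence
-- d_i (c x) - d_i x = ⟨λ , c x α_i⟩ is linear in α_i, and its a-weighted sum vanishes because
-- Σ a_i α_i = 0 (with α_0 = -θ).  On the right, heights ≡ 1 (mod h) force c to permute the affine
-- simple roots α_0, …, α_r; the unique linear relation among them shows that this permutation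
-- preserves the marks a_i, so cdes (x c) = cdes x.

open import Defs
open import Data.Nat as ℕ using (ℕ; zero; suc; z≤n; s≤s)
import Data.Nat.Properties as ℕP
open import Data.Nat.Induction using (<-wellFounded)
open import Induction.WellFounded using (Acc; acc)
open import Data.Integer as ℤ using (ℤ; +_; -_; _+_; _-_; _*_; _≤_; _<_; 0ℤ; 1ℤ)
open import Data.Integer.Base using (+≤+; +<+)
import Data.Integer.Properties as ℤP
open import Data.Integer.Divisibility.Signed using (_∣_; divides; quotient; ∣ᵤ⇒∣; ∣⇒∣ᵤ)
open import Data.Integer.Tactic.RingSolver using (solve-∀)
open import Data.Fin as Fin using (Fin; zero; suc; toℕ; fromℕ<)
open import Data.Fin.Permutation using (permutation)
open import Data.Fin.Properties using (all?; toℕ-fromℕ<; ¬∀⟶∃¬)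
open import Data.Bool using (Bool; true; false; not) renaming (_≟_ to _≟ᵇ_)
open import Data.Bool.Properties using (¬-not; not-involutive)
open import Data.List
  using (List; []; _∷_; _++_; [_]; _∷ʳ_; length; map; reverse; filter; allFin; cartesianProductWith; InitLast; initLast; _∷ʳ′_)
import Data.List.Properties as List
open import Data.List.Membership.Propositional using (_∈_)
open import Data.List.Membership.Propositional.Properties using (∈-allFin; ∈-cartesianProductWith⁺; ∈-filter⁺)
open import Data.List.Relation.Unary.Any using (here; there)
import Data.List.Relation.Unary.All as All
open import Data.List.Relation.Unary.All.Properties using (all-filter)
open import Data.List.Extrema.Nat using (argmin; argmin-all; f[argmin]≤f[⊤]; f[argmin]≤f[xs])
open import Data.Empty using (⊥; ⊥-elim)
open import Data.Unit using (tt)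
open import Data.Product using (Σ-syntax; _×_; _,_; proj₁; proj₂)
open import Data.Sum using (_⊎_; inj₁; inj₂)
open import Function using (_∘_)
open import Relation.Binary.PropositionalEquality
  using (_≡_; _≢_; refl; sym; trans; cong; cong₂; subst; subst₂; _≗_; module ≡-Reasoning)
open import Relation.Nullary using (¬_; Dec; yes; no)
open import Relation.Nullary.Decidable using (map′; toWitness; _×-dec_)
open import Relation.Nullary.Negation using (contradiction)
open import Algebra.Properties.Semiring.Sum ℤP.+-*-semiring
  using (sum; ∑-distrib-+; *-distribˡ-sum; sum-permute)

-- Finite sums

private
  variable
    n : ℕ

sumℤ≡sum : (f : Fin n → ℤ) → sumℤ f ≡ sum f
sumℤ≡sum {zero}  f = refl
sumℤ≡sum {suc n} f = cong (_+_ (f zero)) (sumℤ≡sum (f ∘ suc))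

sumℤ-cong : {f g : Fin n → ℤ} → (∀ i → f i ≡ g i) → sumℤ f ≡ sumℤ g
sumℤ-cong {zero}  f≗g = refl
sumℤ-cong {suc n} f≗g = cong₂ _+_ (f≗g zero) (sumℤ-cong (f≗g ∘ suc))

sumℤ-zero : ∀ n → sumℤ {n} (λ _ → 0ℤ) ≡ 0ℤ
sumℤ-zero zero    = refl
sumℤ-zero (suc n) = trans (ℤP.+-identityˡ _) (sumℤ-zero n)

sumℤ-distrib-+ : (f g : Fin n → ℤ) → sumℤ (λ i → f i + g i) ≡ sumℤ f + sumℤ g
sumℤ-distrib-+ f g = begin
  sumℤ (λ i → f i + g i)  ≡⟨ sumℤ≡sum (λ i → f i + g i) ⟩
  sum (λ i → f i + g i)   ≡⟨ ∑-distrib-+ f g ⟩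
  sum f + sum g           ≡⟨ cong₂ _+_ (sumℤ≡sum f) (sumℤ≡sum g) ⟨
  sumℤ f + sumℤ g         ∎
  where open ≡-Reasoning

*-distribˡ-sumℤ : (c : ℤ) (f : Fin n → ℤ) → sumℤ (λ i → c * f i) ≡ c * sumℤ f
*-distribˡ-sumℤ c f = begin
  sumℤ (λ i → c * f i)  ≡⟨ sumℤ≡sum (λ i → c * f i) ⟩
  sum (λ i → c * f i)   ≡⟨ *-distribˡ-sum c f ⟨
  c * sum f             ≡⟨ cong (c *_) (sumℤ≡sum f) ⟨
  c * sumℤ f            ∎
  where open ≡-Reasoning

sumℤ-neg : (f : Fin n → ℤ) → sumℤ (λ i → - f i) ≡ - sumℤ f
sumℤ-neg f = begin
  sumℤ (λ i → - f i)        ≡⟨ sumℤ-cong (λ i → ℤP.-1*i≡-i (f i)) ⟨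
  sumℤ (λ i → - 1ℤ * f i)   ≡⟨ *-distribˡ-sumℤ (- 1ℤ) f ⟩
  - 1ℤ * sumℤ f             ≡⟨ ℤP.-1*i≡-i (sumℤ f) ⟩
  - sumℤ f                  ∎
  where open ≡-Reasoning

sumℤ-distrib-sub : (f g : Fin n → ℤ) → sumℤ (λ i → f i - g i) ≡ sumℤ f - sumℤ g
sumℤ-distrib-sub f g = trans (sumℤ-distrib-+ f (λ i → - g i)) (cong (_+_ (sumℤ f)) (sumℤ-neg g))

sumℤ-permute : (σ σ⁻¹ : Fin n → Fin n) → (∀ j → σ (σ⁻¹ j) ≡ j) → (∀ i → σ⁻¹ (σ i) ≡ i) →
               (f : Fin n → ℤ) → sumℤ (f ∘ σ) ≡ sumℤ f
sumℤ-permute σ σ⁻¹ σσ⁻¹ σ⁻¹σ f = begin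
  sumℤ (f ∘ σ)  ≡⟨ sumℤ≡sum (f ∘ σ) ⟩
  sum (f ∘ σ)   ≡⟨ sum-permute f (permutation σ σ⁻¹ σσ⁻¹ σ⁻¹σ) ⟨
  sum f         ≡⟨ sumℤ≡sum f ⟨
  sumℤ f        ∎
  where open ≡-Reasoning

sumℤ-mono-≤ : {f g : Fin n → ℤ} → (∀ i → f i ≤ g i) → sumℤ f ≤ sumℤ g
sumℤ-mono-≤ {zero}  f≤g = ℤP.≤-refl
sumℤ-mono-≤ {suc n} f≤g = ℤP.+-mono-≤ (f≤g zero) (sumℤ-mono-≤ (f≤g ∘ suc))

sumℤ-mono-< : {f g : Fin n → ℤ} → (∀ i → f i ≤ g i) → ∀ k → f k < g k → sumℤ f < sumℤ g
sumℤ-mono-< {suc n} f≤g zero    fk<gk = ℤP.+-mono-<-≤ fk<gk (sumℤ-mono-≤ (f≤g ∘ suc))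
sumℤ-mono-< {suc n} f≤g (suc k) fk<gk = ℤP.+-mono-≤-< (f≤g zero) (sumℤ-mono-< (f≤g ∘ suc) k fk<gk)

sumℤ-≤∧≡⇒≗ : {f g : Fin n → ℤ} → (∀ i → f i ≤ g i) → sumℤ f ≡ sumℤ g → ∀ i → f i ≡ g i
sumℤ-≤∧≡⇒≗ {f = f} {g} f≤g Σf≡Σg i with f i ℤ.≟ g i
... | yes fi≡gi = fi≡gi
... | no  fi≢gi = contradiction Σf≡Σg (ℤP.<⇒≢ (sumℤ-mono-< f≤g i (ℤP.≤∧≢⇒< (f≤g i) fi≢gi)))

nonzero-coordinate : {f : Fin n → ℤ} → ¬ (∀ i → f i ≡ 0ℤ) → Σ[ k ∈ Fin n ] f k ≢ 0ℤ
nonzero-coordinate {n} {f} f≢0 = ¬∀⟶∃¬ n (λ i → f i ≡ 0ℤ) (λ i → f i ℤ.≟ 0ℤ) f≢0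

unit-diag : (i : Fin n) → unit i i ≡ 1ℤ
unit-diag i with i Fin.≟ i
... | yes _  = refl
... | no i≢i = contradiction refl i≢i

unit-offdiag : {i k : Fin n} → i ≢ k → unit i k ≡ 0ℤ
unit-offdiag {i = i} {k} i≢k with i Fin.≟ k
... | yes i≡k = contradiction i≡k i≢k
... | no  _   = refl

unit-sym : (i k : Fin n) → unit i k ≡ unit k i
unit-sym i k with i Fin.≟ k
... | yes refl = sym (unit-diag i)
... | no  i≢k  = sym (unit-offdiag (i≢k ∘ sym))

unit-suc : (i k : Fin n) → unit (suc i) (suc k) ≡ unit i k
unit-suc i k with i Fin.≟ k
... | yes _ = refl
... | no  _ = refl

unit-nonneg : (i k : Fin n) → 0ℤ ≤ unit i k
unit-nonneg i k with i Fin.≟ k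
... | yes _ = +≤+ ℕ.z≤n
... | no  _ = +≤+ ℕ.z≤n

sumℤ-*unit : (f : Fin n → ℤ) (k : Fin n) → sumℤ (λ j → f j * unit k j) ≡ f k
sumℤ-*unit {suc n} f zero = begin
  f zero * 1ℤ + sumℤ (λ j → f (suc j) * 0ℤ)  ≡⟨ cong₂ _+_ (ℤP.*-identityʳ (f zero)) (sumℤ-cong (λ j → ℤP.*-zeroʳ (f (suc j)))) ⟩
  f zero + sumℤ {n} (λ _ → 0ℤ)                ≡⟨ cong (_+_ (f zero)) (sumℤ-zero n) ⟩
  f zero + 0ℤ                                 ≡⟨ ℤP.+-identityʳ (f zero) ⟩
  f zero                                      ∎
  where open ≡-Reasoning
sumℤ-*unit {suc n} f (suc k) = begin
  f zero * 0ℤ + sumℤ (λ j → f (suc j) * unit (suc k) (suc j))  ≡⟨ cong₂ _+_ (ℤP.*-zeroʳ (f zero)) (sumℤ-cong (λ j → cong (f (suc j) *_) (unit-suc k j))) ⟩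
  0ℤ + sumℤ (λ j → f (suc j) * unit k j)           ≡⟨ ℤP.+-identityˡ _ ⟩
  sumℤ (λ j → f (suc j) * unit k j)                ≡⟨ sumℤ-*unit (f ∘ suc) k ⟩
  f (suc k)                                        ∎
  where open ≡-Reasoning

unit*-sumℤ : (f : Fin n → ℤ) (k : Fin n) → sumℤ (λ j → unit j k * f j) ≡ f k
unit*-sumℤ f k = trans (sumℤ-cong (λ j → trans (ℤP.*-comm (unit j k) (f j)) (cong (f j *_) (unit-sym j k)))) (sumℤ-*unit f k)

sumℤ-unit : (k : Fin n) → sumℤ (unit k) ≡ 1ℤ
sumℤ-unit k = trans (sumℤ-cong (λ j → sym (ℤP.*-identityˡ (unit k j)))) (sumℤ-*unit (λ _ → 1ℤ) k)

nonneg∧sumℤ≡1⇒unit : {f : Fin n → ℤ} → (∀ i → 0ℤ ≤ f i) → sumℤ f ≡ 1ℤ → Σ[ k ∈ Fin n ] (∀ i → f i ≡ unit k i)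
nonneg∧sumℤ≡1⇒unit {n} {f} f≥0 Σf≡1 = k , λ i → sym (sumℤ-≤∧≡⇒≗ unit≤f (trans (sumℤ-unit k) (sym Σf≡1)) i)
  where
  f≢0 : ¬ (∀ i → f i ≡ 0ℤ)
  f≢0 f≡0 = contradiction (trans (sym (trans (sumℤ-cong f≡0) (sumℤ-zero n))) Σf≡1) (λ ())
  k = proj₁ (nonzero-coordinate f≢0)
  unit≤f : ∀ i → unit k i ≤ f i
  unit≤f i with k Fin.≟ i
  ... | yes refl = ℤP.i<j⇒suc[i]≤j (ℤP.≤∧≢⇒< (f≥0 k) (proj₂ (nonzero-coordinate f≢0) ∘ sym))
  ... | no  _    = f≥0 i

-- Integer residues

χ<0 : ℤ → ℤ
χ<0 z with z ℤP.<? 0ℤ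
... | yes _ = 1ℤ
... | no  _ = 0ℤ

χ<0-neg : ∀ {z} → z < 0ℤ → χ<0 z ≡ 1ℤ
χ<0-neg {z} z<0 with z ℤP.<? 0ℤ
... | yes _   = refl
... | no  z≮0 = contradiction z<0 z≮0

χ<0-nonNeg : ∀ {z} → 0ℤ ≤ z → χ<0 z ≡ 0ℤ
χ<0-nonNeg {z} 0≤z with z ℤP.<? 0ℤ
... | yes z<0 = contradiction 0≤z (ℤP.<⇒≱ z<0)
... | no  _   = refl

0<j-i⇒i<j : ∀ {i j} → 0ℤ < j - i → i < j
0<j-i⇒i<j {i} {j} 0<j-i = subst₂ _<_ (ℤP.+-identityʳ i) (cancel i j) (ℤP.+-monoʳ-< i 0<j-i)
  where
  cancel : ∀ i j → i + (j - i) ≡ j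
  cancel = solve-∀

0≤*-nonNeg : ∀ {a b} → 0ℤ ≤ a → 0ℤ ≤ b → 0ℤ ≤ a * b
0≤*-nonNeg {+ m} {+ n} _ _ = subst (0ℤ ≤_) (ℤP.pos-* m n) (+≤+ z≤n)

private
  sum-of-nonNeg≢-2 : ∀ {a b c} → 0ℤ ≤ a → 0ℤ ≤ b → 0ℤ ≤ c → a + b + c ≢ ℤ.-[1+ 1 ]
  sum-of-nonNeg≢-2 0≤a 0≤b 0≤c a+b+c≡-2 with subst (0ℤ ≤_) a+b+c≡-2 (ℤP.+-mono-≤ (ℤP.+-mono-≤ 0≤a 0≤b) 0≤c)
  ... | ()

-- Integers in [-S, S] \ {0} modulo h = 1 + S: adding h exactly when z < 0 lands in [1, S].
module Residues (S : ℤ) (0≤S : 0ℤ ≤ S) where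

  h : ℤ
  h = 1ℤ + S

  InRange : ℤ → Set
  InRange z = - S ≤ z × z ≤ S × z ≢ 0ℤ

  residue : ℤ → ℤ
  residue z = z + h * χ<0 z

  0<h : 0ℤ < h
  0<h = ℤP.<-≤-trans (+<+ (s≤s z≤n)) (ℤP.+-monoʳ-≤ 1ℤ 0≤S)

  0≤h : 0ℤ ≤ h
  0≤h = ℤP.<⇒≤ 0<h

  residue-range : ∀ {z} → InRange z → 1ℤ ≤ residue z × residue z ≤ S
  residue-range {z} (-S≤z , z≤S , z≢0) = by-sign (z ℤP.<? 0ℤ)
    where
    by-sign : Dec (z < 0ℤ) → 1ℤ ≤ residue z × residue z ≤ S
    by-sign (yes z<0) = subst (1ℤ ≤_) z+h≡residue (subst (_≤ z + h) (lower S) (ℤP.+-monoˡ-≤ h -S≤z))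
                      , subst₂ _≤_ (trans (upper S z) z+h≡residue) (ℤP.+-identityˡ S) (ℤP.+-monoˡ-≤ S (ℤP.i<j⇒suc[i]≤j z<0))
      where
      z+h≡residue : z + h ≡ residue z
      z+h≡residue = trans (cong (_+_ z) (sym (ℤP.*-identityʳ h))) (cong (λ c → z + h * c) (sym (χ<0-neg z<0)))
      lower : ∀ S → - S + (1ℤ + S) ≡ 1ℤ
      lower = solve-∀
      upper : ∀ S z → 1ℤ + z + S ≡ z + (1ℤ + S)
      upper = solve-∀
    by-sign (no z≮0) = subst (1ℤ ≤_) z≡residue (ℤP.i<j⇒suc[i]≤j 0<z) , subst (_≤ S) z≡residue z≤S
      where
      0≤z : 0ℤ ≤ z
      0≤z = ℤP.≮⇒≥ z≮0
      0<z : 0ℤ < z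
      0<z = ℤP.≤∧≢⇒< 0≤z (z≢0 ∘ sym)
      plus-zero : ∀ z h → z + h * 0ℤ ≡ z
      plus-zero = solve-∀
      z≡residue : z ≡ residue z
      z≡residue = sym (trans (cong (λ c → z + h * c) (χ<0-nonNeg 0≤z)) (plus-zero z h))

  residue-unique : ∀ {x x′} t → 1ℤ ≤ x → x ≤ S → 1ℤ ≤ x′ → x′ ≤ S → x′ ≡ x + h * t → t ≡ 0ℤ
  residue-unique (+ zero) _ _ _ _ _ = refl
  residue-unique {x} ℤ.+[1+ n ] 1≤x _ _ x′≤S refl = contradiction (shift S x (+ n))
    (sum-of-nonNeg≢-2 (ℤP.i≤j⇒0≤j-i x′≤S) (ℤP.i≤j⇒0≤j-i 1≤x) (0≤*-nonNeg 0≤h (+≤+ z≤n)))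
    where
    shift : ∀ S x n → S - (x + (1ℤ + S) * (1ℤ + n)) + (x - 1ℤ) + (1ℤ + S) * n ≡ ℤ.-[1+ 1 ]
    shift = solve-∀
  residue-unique {x} ℤ.-[1+ n ] _ x≤S 1≤x′ _ refl = contradiction (shift S x (+ n))
    (sum-of-nonNeg≢-2 (ℤP.i≤j⇒0≤j-i 1≤x′) (ℤP.i≤j⇒0≤j-i x≤S) (0≤*-nonNeg 0≤h (+≤+ z≤n)))
    where
    shift : ∀ S x n → x + (1ℤ + S) * - (1ℤ + n) - 1ℤ + (S - x) + (1ℤ + S) * n ≡ ℤ.-[1+ 1 ]
    shift = solve-∀

  χ<0-shift : ∀ {z} m → InRange z → InRange (z - h * m) → χ<0 (z - h * m) ≡ χ<0 z + m
  χ<0-shift {z} m z-range z′-range = begin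
    χ<0 (z - h * m)                              ≡⟨ regroup (χ<0 (z - h * m)) (χ<0 z) m ⟩
    (χ<0 (z - h * m) - χ<0 z - m) + χ<0 z + m    ≡⟨ cong (λ t → t + χ<0 z + m) t≡0 ⟩
    0ℤ + χ<0 z + m                               ≡⟨ cong (_+ m) (ℤP.+-identityˡ (χ<0 z)) ⟩
    χ<0 z + m                                    ∎
    where
    open ≡-Reasoning
    regroup : ∀ a b m → a ≡ (a - b - m) + b + m
    regroup = solve-∀
    differ : ∀ z h m a b → z - h * m + h * a ≡ z + h * b + h * (a - b - m)
    differ = solve-∀
    t≡0 : χ<0 (z - h * m) - χ<0 z - m ≡ 0ℤ
    t≡0 = residue-unique (χ<0 (z - h * m) - χ<0 z - m)
      (proj₁ (residue-range z-range)) (proj₂ (residue-range z-range))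
      (proj₁ (residue-range z′-range)) (proj₂ (residue-range z′-range))
      (differ z h m (χ<0 (z - h * m)) (χ<0 z))

  ≡1-mod-h : ∀ {z} t → InRange z → z ≡ 1ℤ - h * t → z ≡ 1ℤ ⊎ z ≡ - S
  ≡1-mod-h {z} t z-range z≡1-ht = by-sign (z ℤP.<? 0ℤ)
    where
    1≤S : 1ℤ ≤ S
    1≤S = ℤP.≤-trans (proj₁ (residue-range z-range)) (proj₂ (residue-range z-range))
    differ : ∀ h t c → 1ℤ - h * t + h * c ≡ 1ℤ + h * (c - t)
    differ = solve-∀
    t≡χ : t ≡ χ<0 z
    t≡χ = sym (ℤP.i-j≡0⇒i≡j (χ<0 z) t (residue-unique (χ<0 z - t) ℤP.≤-refl 1≤S
      (proj₁ (residue-range z-range)) (proj₂ (residue-range z-range))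
      (trans (cong (λ u → u + h * χ<0 z) z≡1-ht) (differ h t (χ<0 z)))))
    by-sign : Dec (z < 0ℤ) → z ≡ 1ℤ ⊎ z ≡ - S
    by-sign (yes z<0) = inj₂ (trans z≡1-ht (trans (cong (λ c → 1ℤ - h * c) (trans t≡χ (χ<0-neg z<0))) (one-minus-h S)))
      where
      one-minus-h : ∀ S → 1ℤ - (1ℤ + S) * 1ℤ ≡ - S
      one-minus-h = solve-∀
    by-sign (no z≮0)  = inj₁ (trans z≡1-ht (trans (cong (λ c → 1ℤ - h * c) (trans t≡χ (χ<0-nonNeg (ℤP.≮⇒≥ z≮0)))) (minus-zero h)))
      where
      minus-zero : ∀ h → 1ℤ - h * 0ℤ ≡ 1ℤ
      minus-zero = solve-∀

-- Linear functionals and the reflection representation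

record IsLinear {r : ℕ} (f : Vecℤ r → ℤ) : Set where
  field
    resp-≗ : ∀ {β γ} → β ≗ γ → f β ≡ f γ
    +-hom  : ∀ β γ → f (λ k → β k + γ k) ≡ f β + f γ
    *-hom  : ∀ c β → f (λ k → c * β k) ≡ c * f β

module _ {r : ℕ} where

  linear-resp : {f g : Vecℤ r → ℤ} → (∀ β → f β ≡ g β) → IsLinear f → IsLinear g
  linear-resp f≗g f-lin = record
    { resp-≗ = λ β≗γ → trans (sym (f≗g _)) (trans (resp-≗ β≗γ) (f≗g _))
    ; +-hom  = λ β γ → trans (sym (f≗g _)) (trans (+-hom β γ) (cong₂ _+_ (f≗g β) (f≗g γ)))
    ; *-hom  = λ c β → trans (sym (f≗g _)) (trans (*-hom c β) (cong (c *_) (f≗g β)))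
    }
    where open IsLinear f-lin

  coordinate-linear : (k : Fin r) → IsLinear (λ β → β k)
  coordinate-linear k = record { resp-≗ = λ β≗γ → β≗γ k ; +-hom = λ _ _ → refl ; *-hom = λ _ _ → refl }

  combination-linear : ∀ {n} (c : Fin n → ℤ) {f : Fin n → Vecℤ r → ℤ} →
                       (∀ j → IsLinear (f j)) → IsLinear (λ β → sumℤ (λ j → c j * f j β))
  combination-linear c {f} f-lin = record { resp-≗ = respects ; +-hom = additive ; *-hom = homogeneous }
    where
    module F j = IsLinear (f-lin j)
    respects : ∀ {β γ} → β ≗ γ → sumℤ (λ j → c j * f j β) ≡ sumℤ (λ j → c j * f j γ)
    respects β≗γ = sumℤ-cong (λ j → cong (c j *_) (F.resp-≗ j β≗γ))
    additive : ∀ β γ → sumℤ (λ j → c j * f j (λ k → β k + γ k))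
                       ≡ sumℤ (λ j → c j * f j β) + sumℤ (λ j → c j * f j γ)
    additive β γ = trans (sumℤ-cong (λ j → trans (cong (c j *_) (F.+-hom j β γ)) (ℤP.*-distribˡ-+ (c j) (f j β) (f j γ))))
                         (sumℤ-distrib-+ (λ j → c j * f j β) (λ j → c j * f j γ))
    swap : ∀ x a y → x * (a * y) ≡ a * (x * y)
    swap = solve-∀
    homogeneous : ∀ a β → sumℤ (λ j → c j * f j (λ k → a * β k)) ≡ a * sumℤ (λ j → c j * f j β)
    homogeneous a β = trans (sumℤ-cong (λ j → trans (cong (c j *_) (F.*-hom j a β)) (swap (c j) a (f j β))))
                            (*-distribˡ-sumℤ a (λ j → c j * f j β))

  minus-scaled-linear : {f g : Vecℤ r → ℤ} → IsLinear f → IsLinear g → (c : ℤ) →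
                        IsLinear (λ β → f β - g β * c)
  minus-scaled-linear {f} {g} f-lin g-lin c = record
    { resp-≗ = λ β≗γ → cong₂ (λ x y → x - y * c) (F.resp-≗ β≗γ) (G.resp-≗ β≗γ)
    ; +-hom  = λ β γ → trans (cong₂ (λ x y → x - y * c) (F.+-hom β γ) (G.+-hom β γ)) (distrib (f β) (f γ) (g β) (g γ) c)
    ; *-hom  = λ a β → trans (cong₂ (λ x y → x - y * c) (F.*-hom a β) (G.*-hom a β)) (factor a (f β) (g β) c)
    }
    where
    module F = IsLinear f-lin
    module G = IsLinear g-lin
    distrib : ∀ x x′ y y′ c → x + x′ - (y + y′) * c ≡ (x - y * c) + (x′ - y′ * c)
    distrib = solve-∀
    factor : ∀ a x y c → a * x - a * y * c ≡ a * (x - y * c)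
    factor = solve-∀

  module _ {f : Vecℤ r → ℤ} (f-lin : IsLinear f) where
    open IsLinear f-lin

    linear-zero : f (λ _ → 0ℤ) ≡ 0ℤ
    linear-zero = trans (resp-≗ (λ _ → sym (ℤP.*-zeroˡ 0ℤ))) (trans (*-hom 0ℤ (λ _ → 0ℤ)) (ℤP.*-zeroˡ (f (λ _ → 0ℤ))))

    linear-neg : ∀ β → f (negV β) ≡ - f β
    linear-neg β = trans (resp-≗ (λ k → sym (ℤP.-1*i≡-i (β k))))
                         (trans (*-hom (- 1ℤ) β) (ℤP.-1*i≡-i (f β)))

    linear-combination : ∀ {n} (c : Fin n → ℤ) (v : Fin n → Vecℤ r) →
                         f (λ k → sumℤ (λ j → c j * v j k)) ≡ sumℤ (λ j → c j * f (v j))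
    linear-combination {zero}  c v = linear-zero
    linear-combination {suc n} c v = begin
      f (λ k → c zero * v zero k + sumℤ (λ j → c (suc j) * v (suc j) k))
        ≡⟨ +-hom _ _ ⟩
      f (λ k → c zero * v zero k) + f (λ k → sumℤ (λ j → c (suc j) * v (suc j) k))
        ≡⟨ cong₂ _+_ (*-hom (c zero) (v zero)) (linear-combination (c ∘ suc) (v ∘ suc)) ⟩
      c zero * f (v zero) + sumℤ (λ j → c (suc j) * f (v (suc j)))
        ∎
      where open ≡-Reasoning

    linear-expand : ∀ β → f β ≡ sumℤ (λ j → β j * f (unit j))
    linear-expand β = trans (resp-≗ (λ k → sym (trans (sumℤ-cong (λ j → ℤP.*-comm (β j) (unit j k))) (unit*-sumℤ β k))))
                            (linear-combination β unit)

pairing : ∀ {r} → Vecℤ r → Vecℤ r → ℤ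
pairing μ β = sumℤ (λ k → μ k * β k)

module _ {r : ℕ} (A : Matrix r) where

  coroot : Fin r → Vecℤ r → ℤ
  coroot i β = sumℤ (λ j → A i j * β j)

  coroot-linear : ∀ i → IsLinear (coroot i)
  coroot-linear i = combination-linear (A i) coordinate-linear

  coroot-unit : ∀ i j → coroot i (unit j) ≡ A i j
  coroot-unit i j = sumℤ-*unit (A i) j

  sRoot-formula : ∀ i β k → sRoot A i β k ≡ β k - coroot i β * unit i k
  sRoot-formula i β k with i Fin.≟ k
  ... | yes _ = cong (_-_ (β k)) (sym (ℤP.*-identityʳ (coroot i β)))
  ... | no  _ = sym (trans (cong (_-_ (β k)) (ℤP.*-zeroʳ (coroot i β))) (ℤP.+-identityʳ (β k)))

  actRoot-linear : ∀ w k → IsLinear (λ β → actRoot A w β k)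
  actRoot-linear []      k = coordinate-linear k
  actRoot-linear (i ∷ w) k = linear-resp (λ β → sym (sRoot-formula i (actRoot A w β) k))
    (minus-scaled-linear (actRoot-linear w k) (combination-linear (A i) (actRoot-linear w)) (unit i k))

  actRoot-cong : ∀ w {β γ} → β ≗ γ → actRoot A w β ≗ actRoot A w γ
  actRoot-cong w β≗γ k = IsLinear.resp-≗ (actRoot-linear w k) β≗γ

  actRoot-++ : ∀ u v β → actRoot A (u ++ v) β ≡ actRoot A u (actRoot A v β)
  actRoot-++ []      v β = refl
  actRoot-++ (i ∷ u) v β = cong (sRoot A i) (actRoot-++ u v β)

  actCoweight-linear : ∀ w k → IsLinear (λ μ → actCoweight A w μ k)
  actCoweight-linear []      k = coordinate-linear k
  actCoweight-linear (i ∷ w) k =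
    minus-scaled-linear (actCoweight-linear w k) (actCoweight-linear w i) (A i k)

  actCoweight-cong : ∀ w {μ ν} → μ ≗ ν → actCoweight A w μ ≗ actCoweight A w ν
  actCoweight-cong w μ≗ν k = IsLinear.resp-≗ (actCoweight-linear w k) μ≗ν

  actCoweight-++ : ∀ u v μ → actCoweight A (u ++ v) μ ≡ actCoweight A u (actCoweight A v μ)
  actCoweight-++ []      v μ = refl
  actCoweight-++ (i ∷ u) v μ = cong (sCoweight A i) (actCoweight-++ u v μ)

  pairing-sRootʳ : ∀ μ i β → pairing μ (sRoot A i β) ≡ pairing μ β - coroot i β * μ i
  pairing-sRootʳ μ i β = begin
    sumℤ (λ k → μ k * sRoot A i β k)
      ≡⟨ sumℤ-cong (λ k → trans (cong (μ k *_) (sRoot-formula i β k)) (expand (μ k) (β k) (coroot i β) (unit i k))) ⟩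
    sumℤ (λ k → μ k * β k - coroot i β * (μ k * unit i k))
      ≡⟨ sumℤ-distrib-sub (λ k → μ k * β k) (λ k → coroot i β * (μ k * unit i k)) ⟩
    pairing μ β - sumℤ (λ k → coroot i β * (μ k * unit i k))
      ≡⟨ cong (_-_ (pairing μ β)) (trans (*-distribˡ-sumℤ (coroot i β) (λ k → μ k * unit i k)) (cong (coroot i β *_) (sumℤ-*unit μ i))) ⟩
    pairing μ β - coroot i β * μ i
      ∎
    where
    open ≡-Reasoning
    expand : ∀ m b c u → m * (b - c * u) ≡ m * b - c * (m * u)
    expand = solve-∀

  pairing-sCoweightˡ : ∀ i μ β → pairing (sCoweight A i μ) β ≡ pairing μ β - μ i * coroot i β
  pairing-sCoweightˡ i μ β = begin
    sumℤ (λ k → (μ k - μ i * A i k) * β k)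
      ≡⟨ sumℤ-cong (λ k → expand (μ k) (μ i) (A i k) (β k)) ⟩
    sumℤ (λ k → μ k * β k - μ i * (A i k * β k))
      ≡⟨ sumℤ-distrib-sub (λ k → μ k * β k) (λ k → μ i * (A i k * β k)) ⟩
    pairing μ β - sumℤ (λ k → μ i * (A i k * β k))
      ≡⟨ cong (_-_ (pairing μ β)) (*-distribˡ-sumℤ (μ i) (λ k → A i k * β k)) ⟩
    pairing μ β - μ i * coroot i β
      ∎
    where
    open ≡-Reasoning
    expand : ∀ m mi a b → (m - mi * a) * b ≡ m * b - mi * (a * b)
    expand = solve-∀

  module _ (diag : ∀ i → A i i ≡ + 2) where

    coroot-sRoot : ∀ i β → coroot i (sRoot A i β) ≡ - coroot i β
    coroot-sRoot i β = begin
      coroot i (sRoot A i β)                         ≡⟨ IsLinear.resp-≗ (coroot-linear i) (sRoot-formula i β) ⟩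
      coroot i (λ k → β k - coroot i β * unit i k)   ≡⟨ IsLinear.+-hom (coroot-linear i) β _ ⟩
      coroot i β + coroot i (λ k → - (coroot i β * unit i k))
        ≡⟨ cong (_+_ (coroot i β)) (linear-neg (coroot-linear i) (λ k → coroot i β * unit i k)) ⟩
      coroot i β + - coroot i (λ k → coroot i β * unit i k)
        ≡⟨ cong (λ x → coroot i β + - x) (IsLinear.*-hom (coroot-linear i) (coroot i β) (unit i)) ⟩
      coroot i β - coroot i β * coroot i (unit i)    ≡⟨ cong (λ x → coroot i β - coroot i β * x) (trans (coroot-unit i i) (diag i)) ⟩
      coroot i β - coroot i β * + 2                  ≡⟨ twice (coroot i β) ⟩
      - coroot i β                                   ∎
      where
      open ≡-Reasoning
      twice : ∀ x → x - x * + 2 ≡ - x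
      twice = solve-∀

    sRoot-involutive : ∀ i β → sRoot A i (sRoot A i β) ≗ β
    sRoot-involutive i β k = begin
      sRoot A i (sRoot A i β) k                                         ≡⟨ sRoot-formula i (sRoot A i β) k ⟩
      sRoot A i β k - coroot i (sRoot A i β) * unit i k                 ≡⟨ cong₂ (λ x y → x - y * unit i k) (sRoot-formula i β k) (coroot-sRoot i β) ⟩
      β k - coroot i β * unit i k - - coroot i β * unit i k             ≡⟨ cancel (β k) (coroot i β) (unit i k) ⟩
      β k                                                               ∎
      where
      open ≡-Reasoning
      cancel : ∀ b c u → b - c * u - - c * u ≡ b
      cancel = solve-∀

    sRoot-unit : ∀ i → sRoot A i (unit i) ≗ negV (unit i)
    sRoot-unit i k = begin
      sRoot A i (unit i) k                          ≡⟨ sRoot-formula i (unit i) k ⟩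
      unit i k - coroot i (unit i) * unit i k       ≡⟨ cong (λ x → unit i k - x * unit i k) (trans (coroot-unit i i) (diag i)) ⟩
      unit i k - + 2 * unit i k                     ≡⟨ flip (unit i k) ⟩
      - unit i k                                    ∎
      where
      open ≡-Reasoning
      flip : ∀ u → u - + 2 * u ≡ - u
      flip = solve-∀

    actRoot-reverseˡ : ∀ w β → actRoot A (reverse w) (actRoot A w β) ≗ β
    actRoot-reverseˡ []      β k = refl
    actRoot-reverseˡ (i ∷ w) β k = begin
      actRoot A (reverse (i ∷ w)) (actRoot A (i ∷ w) β) k
        ≡⟨ cong (λ u → actRoot A u (actRoot A (i ∷ w) β) k) (List.unfold-reverse i w) ⟩
      actRoot A (reverse w ++ [ i ]) (sRoot A i (actRoot A w β)) k
        ≡⟨ cong (λ γ → γ k) (actRoot-++ (reverse w) [ i ] _) ⟩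
      actRoot A (reverse w) (sRoot A i (sRoot A i (actRoot A w β))) k
        ≡⟨ actRoot-cong (reverse w) (sRoot-involutive i (actRoot A w β)) k ⟩
      actRoot A (reverse w) (actRoot A w β) k
        ≡⟨ actRoot-reverseˡ w β k ⟩
      β k ∎
      where open ≡-Reasoning

    actRoot-reverseʳ : ∀ w β → actRoot A w (actRoot A (reverse w) β) ≗ β
    actRoot-reverseʳ w β k = trans (cong (λ u → actRoot A u (actRoot A (reverse w) β) k) (sym (List.reverse-involutive w)))
                                   (actRoot-reverseˡ (reverse w) β k)

    sCoweight-involutive : ∀ i μ → sCoweight A i (sCoweight A i μ) ≗ μ
    sCoweight-involutive i μ k = trans (cong (λ a → μ k - μ i * A i k - (μ i - μ i * a) * A i k) (diag i)) (cancel (μ k) (μ i) (A i k))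
      where
      cancel : ∀ m mi a → m - mi * a - (mi - mi * + 2) * a ≡ m
      cancel = solve-∀

    actCoweight-reverseˡ : ∀ w μ → actCoweight A (reverse w) (actCoweight A w μ) ≗ μ
    actCoweight-reverseˡ []      μ k = refl
    actCoweight-reverseˡ (i ∷ w) μ k = begin
      actCoweight A (reverse (i ∷ w)) (actCoweight A (i ∷ w) μ) k
        ≡⟨ cong (λ u → actCoweight A u (actCoweight A (i ∷ w) μ) k) (List.unfold-reverse i w) ⟩
      actCoweight A (reverse w ++ [ i ]) (sCoweight A i (actCoweight A w μ)) k
        ≡⟨ cong (λ ν → ν k) (actCoweight-++ (reverse w) [ i ] _) ⟩
      actCoweight A (reverse w) (sCoweight A i (sCoweight A i (actCoweight A w μ))) k
        ≡⟨ actCoweight-cong (reverse w) (sCoweight-involutive i (actCoweight A w μ)) k ⟩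
      actCoweight A (reverse w) (actCoweight A w μ) k
        ≡⟨ actCoweight-reverseˡ w μ k ⟩
      μ k ∎
      where open ≡-Reasoning

    pairing-invariant : ∀ w μ β → pairing (actCoweight A w μ) (actRoot A w β) ≡ pairing μ β
    pairing-invariant []      μ β = refl
    pairing-invariant (i ∷ w) μ β = begin
      pairing (sCoweight A i μ′) (sRoot A i β′)
        ≡⟨ pairing-sRootʳ (sCoweight A i μ′) i β′ ⟩
      pairing (sCoweight A i μ′) β′ - coroot i β′ * sCoweight A i μ′ i
        ≡⟨ cong₂ (λ x a → x - coroot i β′ * (μ′ i - μ′ i * a)) (pairing-sCoweightˡ i μ′ β′) (diag i) ⟩
      pairing μ′ β′ - μ′ i * coroot i β′ - coroot i β′ * (μ′ i - μ′ i * + 2)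
        ≡⟨ cancel (pairing μ′ β′) (μ′ i) (coroot i β′) ⟩
      pairing μ′ β′
        ≡⟨ pairing-invariant w μ β ⟩
      pairing μ β ∎
      where
      open ≡-Reasoning
      μ′ = actCoweight A w μ
      β′ = actRoot A w β
      cancel : ∀ p m c → p - m * c - c * (m - m * + 2) ≡ p
      cancel = solve-∀

-- Word equivalence and length

module Words {r : ℕ} (A : Matrix r) where

  infix 4 _≈_

  record _≈_ (u v : List (Fin r)) : Set where
    constructor mk≈
    field on-simple : ∀ i → actRoot A u (unit i) ≗ actRoot A v (unit i)

  open _≈_

  ≈-refl : ∀ {u} → u ≈ u
  ≈-refl = mk≈ λ i k → refl

  ≈-sym : ∀ {u v} → u ≈ v → v ≈ u
  ≈-sym u≈v = mk≈ λ i k → sym (on-simple u≈v i k)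

  ≈-trans : ∀ {u v w} → u ≈ v → v ≈ w → u ≈ w
  ≈-trans u≈v v≈w = mk≈ λ i k → trans (on-simple u≈v i k) (on-simple v≈w i k)

  _≈?_ : ∀ u v → Dec (u ≈ v)
  u ≈? v = map′ mk≈ on-simple (all? (λ i → all? (λ k → actRoot A u (unit i) k ℤ.≟ actRoot A v (unit i) k)))

  ≈⇒actRoot-≗ : ∀ {u v} → u ≈ v → ∀ β → actRoot A u β ≗ actRoot A v β
  ≈⇒actRoot-≗ {u} {v} u≈v β k = begin
    actRoot A u β k                              ≡⟨ linear-expand (actRoot-linear A u k) β ⟩
    sumℤ (λ j → β j * actRoot A u (unit j) k)    ≡⟨ sumℤ-cong (λ j → cong (β j *_) (on-simple u≈v j k)) ⟩
    sumℤ (λ j → β j * actRoot A v (unit j) k)    ≡⟨ linear-expand (actRoot-linear A v k) β ⟨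
    actRoot A v β k                              ∎
    where open ≡-Reasoning

  ++-congˡ : ∀ w {u v} → u ≈ v → w ++ u ≈ w ++ v
  ++-congˡ w {u} {v} u≈v = mk≈ λ i k → begin
    actRoot A (w ++ u) (unit i) k              ≡⟨ cong (λ β → β k) (actRoot-++ A w u (unit i)) ⟩
    actRoot A w (actRoot A u (unit i)) k       ≡⟨ actRoot-cong A w (on-simple u≈v i) k ⟩
    actRoot A w (actRoot A v (unit i)) k       ≡⟨ cong (λ β → β k) (actRoot-++ A w v (unit i)) ⟨
    actRoot A (w ++ v) (unit i) k              ∎
    where open ≡-Reasoning

  ++-congʳ : ∀ w {u v} → u ≈ v → u ++ w ≈ v ++ w
  ++-congʳ w {u} {v} u≈v = mk≈ λ i k → begin
    actRoot A (u ++ w) (unit i) k              ≡⟨ cong (λ β → β k) (actRoot-++ A u w (unit i)) ⟩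
    actRoot A u (actRoot A w (unit i)) k       ≡⟨ ≈⇒actRoot-≗ u≈v (actRoot A w (unit i)) k ⟩
    actRoot A v (actRoot A w (unit i)) k       ≡⟨ cong (λ β → β k) (actRoot-++ A v w (unit i)) ⟨
    actRoot A (v ++ w) (unit i) k              ∎
    where open ≡-Reasoning

  wordsUpTo : ℕ → List (List (Fin r))
  wordsUpTo zero    = [ [] ]
  wordsUpTo (suc n) = [] ∷ cartesianProductWith _∷_ (allFin r) (wordsUpTo n)

  ∈-wordsUpTo : ∀ w {n} → length w ℕ.≤ n → w ∈ wordsUpTo n
  ∈-wordsUpTo []      {zero}  _         = here refl
  ∈-wordsUpTo []      {suc n} _         = here refl
  ∈-wordsUpTo (i ∷ w) {suc n} (s≤s |w|≤n) =
    there (∈-cartesianProductWith⁺ _∷_ (∈-allFin i) (∈-wordsUpTo w |w|≤n))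

  reduced : List (Fin r) → List (Fin r)
  reduced w = argmin length w (filter (_≈? w) (wordsUpTo (length w)))

  ℓ : List (Fin r) → ℕ
  ℓ w = length (reduced w)

  reduced-≈ : ∀ w → reduced w ≈ w
  reduced-≈ w = argmin-all length (≈-refl {w}) (all-filter (_≈? w) (wordsUpTo (length w)))

  ℓ≤length : ∀ w → ℓ w ℕ.≤ length w
  ℓ≤length w = f[argmin]≤f[⊤] {f = length} w (filter (_≈? w) (wordsUpTo (length w)))

  ℓ-minimal : ∀ {v w} → v ≈ w → ℓ w ℕ.≤ length v
  ℓ-minimal {v} {w} v≈w with length v ℕ.≤? length w
  ... | yes |v|≤|w| = All.lookup (f[argmin]≤f[xs] {f = length} w _) (∈-filter⁺ (_≈? w) (∈-wordsUpTo v |v|≤|w|) v≈w)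
  ... | no  |v|≰|w| = ℕP.≤-trans (ℓ≤length w) (ℕP.<⇒≤ (ℕP.≰⇒> |v|≰|w|))

  ℓ-resp-≈ : ∀ {v w} → v ≈ w → ℓ v ≡ ℓ w
  ℓ-resp-≈ {v} {w} v≈w = ℕP.≤-antisym
    (ℓ-minimal (≈-trans (reduced-≈ w) (≈-sym v≈w)))
    (ℓ-minimal (≈-trans (reduced-≈ v) v≈w))

  ℓ-++ : ∀ v u → ℓ (v ++ u) ℕ.≤ ℓ v ℕ.+ length u
  ℓ-++ v u = subst (ℓ (v ++ u) ℕ.≤_) (List.length-++ (reduced v)) (ℓ-minimal (++-congʳ u (reduced-≈ v)))

-- Rank-two Cartan submatrices

data FiniteType₂ : ℤ → ℤ → Set where
  A₁×A₁ : FiniteType₂ 0ℤ 0ℤ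
  A₂    : FiniteType₂ ℤ.-[1+ 0 ] ℤ.-[1+ 0 ]
  B₂    : FiniteType₂ ℤ.-[1+ 0 ] ℤ.-[1+ 1 ]
  B₂ᵗ   : FiniteType₂ ℤ.-[1+ 1 ] ℤ.-[1+ 0 ]
  G₂    : FiniteType₂ ℤ.-[1+ 0 ] ℤ.-[1+ 2 ]
  G₂ᵗ   : FiniteType₂ ℤ.-[1+ 2 ] ℤ.-[1+ 0 ]

private
  negative-product<4 : ∀ p q → suc p ℕ.* suc q ℕ.< 4 → FiniteType₂ ℤ.-[1+ p ] ℤ.-[1+ q ]
  negative-product<4 0 0 _ = A₂
  negative-product<4 0 1 _ = B₂
  negative-product<4 1 0 _ = B₂ᵗ
  negative-product<4 0 2 _ = G₂
  negative-product<4 2 0 _ = G₂ᵗ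
  negative-product<4 0 (suc (suc (suc q))) pq<4 =
    contradiction pq<4 (ℕP.≤⇒≯ (ℕP.*-mono-≤ {1} {1} {4} ℕP.≤-refl (s≤s (s≤s (s≤s (s≤s z≤n))))))
  negative-product<4 (suc (suc (suc p))) 0 pq<4 =
    contradiction pq<4 (ℕP.≤⇒≯ (ℕP.*-mono-≤ {4} {suc (suc (suc (suc p)))} {1} {1} (s≤s (s≤s (s≤s (s≤s z≤n)))) ℕP.≤-refl))
  negative-product<4 (suc p) (suc q) pq<4 =
    contradiction pq<4 (ℕP.≤⇒≯ (ℕP.*-mono-≤ {2} {suc (suc p)} {2} {suc (suc q)} (s≤s (s≤s z≤n)) (s≤s (s≤s z≤n))))

finiteType₂ : ∀ {a b} → a ≤ 0ℤ → b ≤ 0ℤ → (a ≡ 0ℤ → b ≡ 0ℤ) → (b ≡ 0ℤ → a ≡ 0ℤ) → a * b < + 4 →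
              FiniteType₂ a b
finiteType₂ {+ 0}       {+ 0}       _ _ _ _ _ = A₁×A₁
finiteType₂ {+ 0}       {ℤ.-[1+ q ]} _ _ a≡0⇒b≡0 _ _ = contradiction (a≡0⇒b≡0 refl) λ ()
finiteType₂ {ℤ.-[1+ p ]} {+ 0}       _ _ _ b≡0⇒a≡0 _ = contradiction (b≡0⇒a≡0 refl) λ ()
finiteType₂ {ℤ.-[1+ p ]} {ℤ.-[1+ q ]} _ _ _ _ ab<4 = negative-product<4 p q (ℤP.drop‿+<+ ab<4)
finiteType₂ {ℤ.+[1+ p ]} (+≤+ ())
finiteType₂ {_} {ℤ.+[1+ q ]} _ (+≤+ ())

module _ {r : ℕ} {A : Matrix r} (cartan : IsIrreducibleCartan A) where
  open IsIrreducibleCartan cartan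

  quadraticForm : Vecℤ r → ℤ
  quadraticForm x = sumℤ (λ i → sumℤ (λ j → x i * (+ d i * A i j) * x j))

  private
    d-nonzero : ∀ k {z} → + d k * z ≡ 0ℤ → z ≡ 0ℤ
    d-nonzero k {z} dz≡0 with d k | d-pos k
    ... | suc n | _ = ℤP.*-cancelˡ-≡ (+ suc n) z 0ℤ (trans dz≡0 (sym (ℤP.*-zeroʳ (+ suc n))))

  cartan-zero-sym : ∀ {i j} → A i j ≡ 0ℤ → A j i ≡ 0ℤ
  cartan-zero-sym {i} {j} Aij≡0 = d-nonzero j (trans (sym (symm i j)) (trans (cong (+ d i *_) Aij≡0) (ℤP.*-zeroʳ (+ d i))))

  quadraticForm-span : ∀ i j p q → quadraticForm (λ k → p * unit i k + q * unit j k)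
    ≡ p * (p * (+ d i * A i i) + q * (+ d i * A i j)) + q * (p * (+ d j * A j i) + q * (+ d j * A j j))
  quadraticForm-span i j p q = trans (sumℤ-cong (λ k → row k)) (pair-sum (λ k → p * C k i + q * C k j))
    where
    C : Fin r → Fin r → ℤ
    C k l = + d k * A k l
    x = λ k → p * unit i k + q * unit j k
    pair-sum : ∀ (g : Fin r → ℤ) → sumℤ (λ k → x k * g k) ≡ p * g i + q * g j
    pair-sum g = begin
      sumℤ (λ k → x k * g k)                                    ≡⟨ sumℤ-cong (λ k → spread p (unit i k) q (unit j k) (g k)) ⟩
      sumℤ (λ k → p * (g k * unit i k) + q * (g k * unit j k))  ≡⟨ sumℤ-distrib-+ (λ k → p * (g k * unit i k)) (λ k → q * (g k * unit j k)) ⟩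
      sumℤ (λ k → p * (g k * unit i k)) + sumℤ (λ k → q * (g k * unit j k))
        ≡⟨ cong₂ _+_ (*-distribˡ-sumℤ p (λ k → g k * unit i k)) (*-distribˡ-sumℤ q (λ k → g k * unit j k)) ⟩
      p * sumℤ (λ k → g k * unit i k) + q * sumℤ (λ k → g k * unit j k)
        ≡⟨ cong₂ (λ u v → p * u + q * v) (sumℤ-*unit g i) (sumℤ-*unit g j) ⟩
      p * g i + q * g j                                         ∎
      where
      open ≡-Reasoning
      spread : ∀ p u q v g → (p * u + q * v) * g ≡ p * (g * u) + q * (g * v)
      spread = solve-∀
    row : ∀ k → sumℤ (λ l → x k * C k l * x l) ≡ x k * (p * C k i + q * C k j)
    row k = trans (sumℤ-cong (λ l → ℤP.*-comm (x k * C k l) (x l)))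
                  (trans (pair-sum (λ l → x k * C k l)) (factor (x k) p (C k i) q (C k j)))
      where
      factor : ∀ y p a q b → p * (y * a) + q * (y * b) ≡ y * (p * a + q * b)
      factor = solve-∀

  module _ {i j : Fin r} (i≢j : i ≢ j) where

    offdiag-product<4 : A i j * A j i < + 4
    offdiag-product<4 = 0<j-i⇒i<j (ℤP.*-cancelˡ-<-nonNeg (+ (2 ℕ.* d j))
      (subst₂ _<_ (sym (ℤP.*-zeroʳ (+ (2 ℕ.* d j)))) value (posdef x (j , x-j≢0))))
      where
      a = A i j
      b = A j i
      x = λ k → - a * unit i k + + 2 * unit j k
      x-j≡2 : x j ≡ + 2
      x-j≡2 = trans (cong₂ (λ u v → - a * u + + 2 * v) (unit-offdiag i≢j) (unit-diag j))
                    (cong (_+ + 2) (ℤP.*-zeroʳ (- a)))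
      x-j≢0 : x j ≢ 0ℤ
      x-j≢0 x-j≡0 = contradiction (trans (sym x-j≡2) x-j≡0) λ ()
      -- The i-th row of the form vanishes on x, leaving 2 (d j) (4 - a b).
      value : quadraticForm x ≡ + (2 ℕ.* d j) * (+ 4 - a * b)
      value = begin
        quadraticForm x
          ≡⟨ quadraticForm-span i j (- a) (+ 2) ⟩
        - a * (- a * (+ d i * A i i) + + 2 * (+ d i * a)) + + 2 * (- a * (+ d j * b) + + 2 * (+ d j * A j j))
          ≡⟨ cong₂ (λ u v → - a * (- a * (+ d i * u) + + 2 * (+ d i * a)) + + 2 * (- a * (+ d j * b) + + 2 * (+ d j * v))) (diag i) (diag j) ⟩
        - a * (- a * (+ d i * + 2) + + 2 * (+ d i * a)) + + 2 * (- a * (+ d j * b) + + 2 * (+ d j * + 2))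
          ≡⟨ evaluate a b (+ d i) (+ d j) ⟩
        + 2 * + d j * (+ 4 - a * b)
          ≡⟨ cong (_* (+ 4 - a * b)) (ℤP.pos-* 2 (d j)) ⟨
        + (2 ℕ.* d j) * (+ 4 - a * b) ∎
        where
        open ≡-Reasoning
        evaluate : ∀ a b di dj → - a * (- a * (di * + 2) + + 2 * (di * a)) + + 2 * (- a * (dj * b) + + 2 * (dj * + 2))
                                 ≡ + 2 * dj * (+ 4 - a * b)
        evaluate = solve-∀

    finiteType₂-cartan : FiniteType₂ (A i j) (A j i)
    finiteType₂-cartan = finiteType₂ (offdiag i j i≢j) (offdiag j i (i≢j ∘ sym))
      cartan-zero-sym cartan-zero-sym offdiag-product<4

-- Rank-two parabolic subgroups

NonNegative : ∀ {r} → Vecℤ r → Set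
NonNegative β = ∀ k → 0ℤ ≤ β k

NonPositive : ∀ {r} → Vecℤ r → Set
NonPositive β = ∀ k → β k ≤ 0ℤ

record NonNegativeCombination {r} (β γ δ : Vecℤ r) : Set where
  field
    x y : ℤ
    0≤x : 0ℤ ≤ x
    0≤y : 0ℤ ≤ y
    δ≗  : δ ≗ λ k → x * β k + y * γ k

-- Words in two letters, false standing for s and true for s′.  Acting on β, such a word adds
-- x α_s + y α_s′ where (x , y) is computed from a = A s s′, b = A s′ s, L = ⟨α_s^∨ , β⟩ and
-- L′ = ⟨α_s′^∨ , β⟩ alone.
displacement : (a b L L′ : ℤ) → List Bool → ℤ × ℤ
displacement a b L L′ []          = 0ℤ , 0ℤ
displacement a b L L′ (false ∷ w) = let x , y = displacement a b L L′ w in x - (L + x * + 2 + y * a) , y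
displacement a b L L′ (true  ∷ w) = let x , y = displacement a b L L′ w in x , y - (L′ + x * b + y * + 2)

superpose : ℤ → ℤ → ℤ × ℤ → ℤ × ℤ → ℤ × ℤ
superpose L L′ (x₁ , y₁) (x₂ , y₂) = L * x₁ + L′ * x₂ , L * y₁ + L′ * y₂

displacement-linear : ∀ a b L L′ w →
  displacement a b L L′ w ≡ superpose L L′ (displacement a b 1ℤ 0ℤ w) (displacement a b 0ℤ 1ℤ w)
displacement-linear a b L L′ [] = cong₂ _,_ (zeros L L′) (zeros L L′)
  where
  zeros : ∀ L L′ → 0ℤ ≡ L * 0ℤ + L′ * 0ℤ
  zeros = solve-∀
displacement-linear a b L L′ (false ∷ w) rewrite displacement-linear a b L L′ w =
  cong₂ _,_ (step L L′ (proj₁ (displacement a b 1ℤ 0ℤ w)) (proj₁ (displacement a b 0ℤ 1ℤ w))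
                       (proj₂ (displacement a b 1ℤ 0ℤ w)) (proj₂ (displacement a b 0ℤ 1ℤ w)) a) refl
  where
  step : ∀ L L′ x₁ x₂ y₁ y₂ a →
         L * x₁ + L′ * x₂ - (L + (L * x₁ + L′ * x₂) * + 2 + (L * y₁ + L′ * y₂) * a)
         ≡ L * (x₁ - (1ℤ + x₁ * + 2 + y₁ * a)) + L′ * (x₂ - (0ℤ + x₂ * + 2 + y₂ * a))
  step = solve-∀
displacement-linear a b L L′ (true ∷ w) rewrite displacement-linear a b L L′ w =
  cong₂ _,_ refl (step L L′ (proj₁ (displacement a b 1ℤ 0ℤ w)) (proj₁ (displacement a b 0ℤ 1ℤ w))
                            (proj₂ (displacement a b 1ℤ 0ℤ w)) (proj₂ (displacement a b 0ℤ 1ℤ w)) b)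
  where
  step : ∀ L L′ x₁ x₂ y₁ y₂ b →
         L * y₁ + L′ * y₂ - (L′ + (L * x₁ + L′ * x₂) * b + (L * y₁ + L′ * y₂) * + 2)
         ≡ L * (y₁ - (0ℤ + x₁ * b + y₁ * + 2)) + L′ * (y₂ - (1ℤ + x₂ * b + y₂ * + 2))
  step = solve-∀

displacement-basis : ∀ a b u v →
  displacement a b 1ℤ 0ℤ u ≡ displacement a b 1ℤ 0ℤ v →
  displacement a b 0ℤ 1ℤ u ≡ displacement a b 0ℤ 1ℤ v →
  ∀ L L′ → displacement a b L L′ u ≡ displacement a b L L′ v
displacement-basis a b u v e₁ e₂ L L′ = begin
  displacement a b L L′ u                                                ≡⟨ displacement-linear a b L L′ u ⟩
  superpose L L′ (displacement a b 1ℤ 0ℤ u) (displacement a b 0ℤ 1ℤ u)  ≡⟨ cong₂ (superpose L L′) e₁ e₂ ⟩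
  superpose L L′ (displacement a b 1ℤ 0ℤ v) (displacement a b 0ℤ 1ℤ v)  ≡⟨ displacement-linear a b L L′ v ⟨
  displacement a b L L′ v                                                ∎
  where open ≡-Reasoning

letterAt : ℕ → Bool
letterAt zero    = true
letterAt (suc k) = not (letterAt k)

alternating : ℕ → List Bool
alternating zero    = []
alternating (suc k) = letterAt k ∷ alternating k

length-alternating : ∀ k → length (alternating k) ≡ k
length-alternating zero    = refl
length-alternating (suc k) = cong suc (length-alternating k)

order : ∀ {a b} → FiniteType₂ a b → ℕ
order A₁×A₁ = 2
order A₂    = 3
order B₂    = 4
order B₂ᵗ   = 4
order G₂    = 6
order G₂ᵗ   = 6

pred-order<order : ∀ {a b} (c : FiniteType₂ a b) → ℕ.pred (order c) ℕ.< order c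
pred-order<order A₁×A₁ = ℕP.n<1+n 1
pred-order<order A₂    = ℕP.n<1+n 2
pred-order<order B₂    = ℕP.n<1+n 3
pred-order<order B₂ᵗ   = ℕP.n<1+n 3
pred-order<order G₂    = ℕP.n<1+n 5
pred-order<order G₂ᵗ   = ℕP.n<1+n 5

private
  braid-basis : ∀ {a b} (c : FiniteType₂ a b) →
    let u = alternating (order c) ++ [ false ]
        v = alternating (ℕ.pred (order c))
    in  displacement a b 1ℤ 0ℤ u ≡ displacement a b 1ℤ 0ℤ v × displacement a b 0ℤ 1ℤ u ≡ displacement a b 0ℤ 1ℤ v
  braid-basis A₁×A₁ = refl , refl
  braid-basis A₂    = refl , refl
  braid-basis B₂    = refl , refl
  braid-basis B₂ᵗ   = refl , refl
  braid-basis G₂    = refl , refl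
  braid-basis G₂ᵗ   = refl , refl

braid-displacement : ∀ {a b} (c : FiniteType₂ a b) L L′ →
  displacement a b L L′ (alternating (order c) ++ [ false ]) ≡ displacement a b L L′ (alternating (ℕ.pred (order c)))
braid-displacement {a} {b} c =
  displacement-basis a b _ _ (proj₁ (braid-basis c)) (proj₂ (braid-basis c))

NonNegative₂ : ℤ × ℤ → Set
NonNegative₂ (x , y) = 0ℤ ≤ x × 0ℤ ≤ y

-- The coefficients of (alternating k) α_s, for L = ⟨α_s^∨ , α_s⟩ = 2 and L′ = ⟨α_s′^∨ , α_s⟩ = b.
alternating-coefficients : (a b : ℤ) → ℕ → ℤ × ℤ
alternating-coefficients a b k = let x , y = displacement a b (+ 2) b (alternating k) in 1ℤ + x , y

private
  nonNegative? : ∀ {a b} (c : FiniteType₂ a b) →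
                 Dec (∀ (k : Fin (order c)) → NonNegative₂ (alternating-coefficients a b (toℕ k)))
  nonNegative? c = all? (λ k → (0ℤ ℤ.≤? _) ×-dec (0ℤ ℤ.≤? _))

  nonNegative : ∀ {a b} (c : FiniteType₂ a b) (k : Fin (order c)) →
                NonNegative₂ (alternating-coefficients a b (toℕ k))
  nonNegative A₁×A₁ = toWitness {a? = nonNegative? A₁×A₁} tt
  nonNegative A₂    = toWitness {a? = nonNegative? A₂} tt
  nonNegative B₂    = toWitness {a? = nonNegative? B₂} tt
  nonNegative B₂ᵗ   = toWitness {a? = nonNegative? B₂ᵗ} tt
  nonNegative G₂    = toWitness {a? = nonNegative? G₂} tt
  nonNegative G₂ᵗ   = toWitness {a? = nonNegative? G₂ᵗ} tt

alternating-nonNegative : ∀ {a b} (c : FiniteType₂ a b) {k} → k ℕ.< order c →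
                          NonNegative₂ (alternating-coefficients a b k)
alternating-nonNegative {a} {b} c k<m =
  subst (NonNegative₂ ∘ alternating-coefficients a b) (toℕ-fromℕ< k<m) (nonNegative c (fromℕ< k<m))

module Parabolic₂ {r : ℕ} (A : Matrix r) (diag : ∀ i → A i i ≡ + 2) (s s′ : Fin r) where
  open Words A

  letter : Bool → Fin r
  letter false = s
  letter true  = s′

  word : List Bool → List (Fin r)
  word = map letter

  coroot-span : ∀ i β x y →
    coroot A i (λ k → β k + x * unit s k + y * unit s′ k) ≡ coroot A i β + x * A i s + y * A i s′
  coroot-span i β x y = begin
    coroot A i (λ k → β k + x * unit s k + y * unit s′ k)
      ≡⟨ +-hom (λ k → β k + x * unit s k) (λ k → y * unit s′ k) ⟩
    coroot A i (λ k → β k + x * unit s k) + coroot A i (λ k → y * unit s′ k)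
      ≡⟨ cong₂ _+_ (+-hom β (λ k → x * unit s k)) (*-hom y (unit s′)) ⟩
    coroot A i β + coroot A i (λ k → x * unit s k) + y * coroot A i (unit s′)
      ≡⟨ cong₂ (λ u v → coroot A i β + u + y * v) (trans (*-hom x (unit s)) (cong (x *_) (coroot-unit A i s))) (coroot-unit A i s′) ⟩
    coroot A i β + x * A i s + y * A i s′
      ∎
    where
    open ≡-Reasoning
    open IsLinear (coroot-linear A i)

  actRoot-word : ∀ ub β →
    let x , y = displacement (A s s′) (A s′ s) (coroot A s β) (coroot A s′ β) ub
    in  actRoot A (word ub) β ≗ λ k → β k + x * unit s k + y * unit s′ k
  actRoot-word [] β k = plus-zeros (β k) (unit s k) (unit s′ k)
    where
    plus-zeros : ∀ b u u′ → b ≡ b + 0ℤ * u + 0ℤ * u′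
    plus-zeros = solve-∀
  actRoot-word (false ∷ ub) β k = begin
    sRoot A s γ k                                          ≡⟨ sRoot-formula A s γ k ⟩
    γ k - coroot A s γ * unit s k                          ≡⟨ cong₂ (λ u v → u - v * unit s k) (actRoot-word ub β k) coroot-γ ⟩
    β k + x * unit s k + y * unit s′ k - (L + x * + 2 + y * A s s′) * unit s k
      ≡⟨ step (β k) x y L (A s s′) (unit s k) (unit s′ k) ⟩
    β k + (x - (L + x * + 2 + y * A s s′)) * unit s k + y * unit s′ k ∎
    where
    open ≡-Reasoning
    γ = actRoot A (word ub) β
    L = coroot A s β
    x = proj₁ (displacement (A s s′) (A s′ s) L (coroot A s′ β) ub)
    y = proj₂ (displacement (A s s′) (A s′ s) L (coroot A s′ β) ub)
    coroot-γ : coroot A s γ ≡ L + x * + 2 + y * A s s′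
    coroot-γ = trans (IsLinear.resp-≗ (coroot-linear A s) (actRoot-word ub β))
                     (trans (coroot-span s β x y) (cong (λ u → L + x * u + y * A s s′) (diag s)))
    step : ∀ b x y L a u u′ → b + x * u + y * u′ - (L + x * + 2 + y * a) * u ≡ b + (x - (L + x * + 2 + y * a)) * u + y * u′
    step = solve-∀
  actRoot-word (true ∷ ub) β k = begin
    sRoot A s′ γ k                                         ≡⟨ sRoot-formula A s′ γ k ⟩
    γ k - coroot A s′ γ * unit s′ k                        ≡⟨ cong₂ (λ u v → u - v * unit s′ k) (actRoot-word ub β k) coroot-γ ⟩
    β k + x * unit s k + y * unit s′ k - (L′ + x * A s′ s + y * + 2) * unit s′ k
      ≡⟨ step (β k) x y L′ (A s′ s) (unit s k) (unit s′ k) ⟩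
    β k + x * unit s k + (y - (L′ + x * A s′ s + y * + 2)) * unit s′ k ∎
    where
    open ≡-Reasoning
    γ = actRoot A (word ub) β
    L′ = coroot A s′ β
    x = proj₁ (displacement (A s s′) (A s′ s) (coroot A s β) L′ ub)
    y = proj₂ (displacement (A s s′) (A s′ s) (coroot A s β) L′ ub)
    coroot-γ : coroot A s′ γ ≡ L′ + x * A s′ s + y * + 2
    coroot-γ = trans (IsLinear.resp-≗ (coroot-linear A s′) (actRoot-word ub β))
                     (trans (coroot-span s′ β x y) (cong (λ u → L′ + x * A s′ s + y * u) (diag s′)))
    step : ∀ b x y L′ a u u′ → b + x * u + y * u′ - (L′ + x * a + y * + 2) * u′ ≡ b + x * u + (y - (L′ + x * a + y * + 2)) * u′
    step = solve-∀

  cancel : ∀ t ub → word (t ∷ t ∷ ub) ≈ word ub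
  cancel t ub = mk≈ λ i → sRoot-involutive A diag (letter t) (actRoot A (word ub) (unit i))

  NoShortcut : List Bool → Set
  NoShortcut ub = ∀ vb → word vb ≈ word (ub ++ [ false ]) → length ub ℕ.≤ length vb

  noShortcut-tail : ∀ t ub → NoShortcut (t ∷ ub) → NoShortcut ub
  noShortcut-tail t ub ns vb vb≈ub = ℕ.s≤s⁻¹ (ns (t ∷ vb) (++-congˡ [ letter t ] vb≈ub))

  noShortcut-no-repeat : ∀ {ub t rest} → NoShortcut ub → ub ++ [ false ] ≡ t ∷ t ∷ rest → ⊥
  noShortcut-no-repeat {ub} {t} {rest} ns ub·s≡ttrest = ℕP.<-irrefl refl (begin-strict
    length rest            <⟨ ℕP.n<1+n (length rest) ⟩
    suc (length rest)      ≡⟨ ℕP.suc-injective (trans (cong length (sym ub·s≡ttrest)) (trans (List.length-++ ub) (ℕP.+-comm (length ub) 1))) ⟩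
    length ub              ≤⟨ ns rest (≈-sym (subst (λ z → word z ≈ word rest) (sym ub·s≡ttrest) (cancel t rest))) ⟩
    length rest            ∎)
    where open ℕP.≤-Reasoning

  noShortcut-letter : ∀ t k → NoShortcut (t ∷ alternating k) → t ≡ letterAt k
  noShortcut-letter true  zero    ns = refl
  noShortcut-letter false zero    ns = ⊥-elim (noShortcut-no-repeat {[ false ]} ns refl)
  noShortcut-letter t     (suc j) ns with t ≟ᵇ letterAt (suc j)
  ... | yes t≡tₖ = t≡tₖ
  ... | no  t≢tₖ = ⊥-elim (noShortcut-no-repeat ns (cong (λ u → t ∷ u ∷ alternating j ++ [ false ]) (sym t≡tⱼ)))
    where
    t≡tⱼ : t ≡ letterAt j
    t≡tⱼ = trans (¬-not t≢tₖ) (not-involutive (letterAt j))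

  module _ (c : FiniteType₂ (A s s′) (A s′ s)) where

    braid : word (alternating (order c) ++ [ false ]) ≈ word (alternating (ℕ.pred (order c)))
    braid = mk≈ λ i k → begin
      actRoot A (word (alternating (order c) ++ [ false ])) (unit i) k
        ≡⟨ actRoot-word (alternating (order c) ++ [ false ]) (unit i) k ⟩
      _ ≡⟨ cong (λ (x , y) → unit i k + x * unit s k + y * unit s′ k) (braid-displacement c (coroot A s (unit i)) (coroot A s′ (unit i))) ⟩
      _ ≡⟨ actRoot-word (alternating (ℕ.pred (order c))) (unit i) k ⟨
      actRoot A (word (alternating (ℕ.pred (order c)))) (unit i) k ∎
      where open ≡-Reasoning

    ¬noShortcut-order : ¬ NoShortcut (alternating (order c))
    ¬noShortcut-order ns = ℕP.<⇒≱ (pred-order<order c)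
      (subst₂ ℕ._≤_ (length-alternating (order c)) (length-alternating (ℕ.pred (order c)))
              (ns (alternating (ℕ.pred (order c))) (≈-sym braid)))

    noShortcut-alternating : ∀ ub → NoShortcut ub → ub ≡ alternating (length ub) × length ub ℕ.< order c
    noShortcut-alternating []       _  = refl , ℕP.≤-<-trans z≤n (pred-order<order c)
    noShortcut-alternating (t ∷ ub) ns with noShortcut-alternating ub (noShortcut-tail t ub ns)
    ... | ub≡alt , |ub|<m = tub≡alt , bound
      where
      tub≡alt : t ∷ ub ≡ alternating (suc (length ub))
      tub≡alt = cong₂ _∷_ (noShortcut-letter t (length ub) (subst (λ u → NoShortcut (t ∷ u)) ub≡alt ns)) ub≡alt
      bound : suc (length ub) ℕ.< order c
      bound with ℕP.m≤n⇒m<n∨m≡n |ub|<m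
      ... | inj₁ |tub|<m = |tub|<m
      ... | inj₂ |tub|≡m = ⊥-elim (¬noShortcut-order (subst (NoShortcut ∘ alternating) |tub|≡m (subst NoShortcut tub≡alt ns)))

    noShortcut-nonNegative : ∀ ub → NoShortcut ub → NonNegativeCombination (unit s) (unit s′) (actRoot A (word ub) (unit s))
    noShortcut-nonNegative ub ns = record
      { x = 1ℤ + x ; y = y ; 0≤x = proj₁ nonNeg ; 0≤y = proj₂ nonNeg ; δ≗ = coefficients }
      where
      ub-alt = noShortcut-alternating ub ns
      x = proj₁ (displacement (A s s′) (A s′ s) (coroot A s (unit s)) (coroot A s′ (unit s)) ub)
      y = proj₂ (displacement (A s s′) (A s′ s) (coroot A s (unit s)) (coroot A s′ (unit s)) ub)
      same-coefficients : (1ℤ + x , y) ≡ alternating-coefficients (A s s′) (A s′ s) (length ub)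
      same-coefficients = cong (λ (L , L′ , w) → let x , y = displacement (A s s′) (A s′ s) L L′ w in 1ℤ + x , y)
        (cong₂ _,_ (trans (coroot-unit A s s) (diag s)) (cong₂ _,_ (coroot-unit A s′ s) (proj₁ ub-alt)))
      nonNeg = subst NonNegative₂ (sym same-coefficients) (alternating-nonNegative c (proj₂ ub-alt))
      coefficients : actRoot A (word ub) (unit s) ≗ λ k → (1ℤ + x) * unit s k + y * unit s′ k
      coefficients k = trans (actRoot-word ub (unit s) k) (regroup (unit s k) x y (unit s′ k))
        where
        regroup : ∀ u x y u′ → u + x * u + y * u′ ≡ (1ℤ + x) * u + y * u′
        regroup = solve-∀

-- Every root is positive or negative

module _ {r : ℕ} {A : Matrix r} (diag : ∀ i → A i i ≡ + 2) where
  open Words A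

  cancelʳ : ∀ u s → (u ++ [ s ]) ++ [ s ] ≈ u
  cancelʳ u s = subst (λ z → z ≈ u) (sym (List.++-assoc u [ s ] [ s ]))
    (subst (λ z → u ++ s ∷ s ∷ [] ≈ z) (List.++-identityʳ u)
           (++-congˡ u (mk≈ λ i → sRoot-involutive A diag s (unit i))))

  module _ (w : List (Fin r)) (s s′ : Fin r) where
    open Parabolic₂ A diag s s′ using (letter; word; cancel)

    record Descent : Set where
      field
        v            : List (Fin r)
        ub           : List Bool
        v·ub≈w       : v ++ word ub ≈ w
        length-bound : ℓ v ℕ.+ length ub ℕ.≤ ℓ w
        ub-nonempty  : 0 ℕ.< length ub
        ascent-s     : ℓ v ℕ.≤ ℓ (v ++ [ s ])
        ascent-s′    : ℓ v ℕ.≤ ℓ (v ++ [ s′ ])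

    descend : ∀ v ub → Acc ℕ._<_ (ℓ v) → v ++ word ub ≈ w → ℓ v ℕ.+ length ub ℕ.≤ ℓ w → 0 ℕ.< length ub →
              Descent
    descend v ub (acc rs) v·ub≈w bound nonempty =
      finish (ℓ (v ++ [ s ]) ℕ.<? ℓ v) (ℓ (v ++ [ s′ ]) ℕ.<? ℓ v)
      where
      peel : ∀ t → ℓ (v ++ [ letter t ]) ℕ.< ℓ v → Descent
      peel t shorter = descend (v ++ [ letter t ]) (t ∷ ub) (rs shorter) v·t·t·ub≈w bound′ (s≤s z≤n)
        where
        v·t·t·ub≈w : (v ++ [ letter t ]) ++ word (t ∷ ub) ≈ w
        v·t·t·ub≈w = subst (_≈ w) (sym (List.++-assoc v [ letter t ] (word (t ∷ ub))))
                           (≈-trans (++-congˡ v (cancel t ub)) v·ub≈w)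
        bound′ : ℓ (v ++ [ letter t ]) ℕ.+ suc (length ub) ℕ.≤ ℓ w
        bound′ = ℕP.≤-trans (ℕP.≤-reflexive (ℕP.+-suc _ (length ub))) (ℕP.≤-trans (ℕP.+-monoˡ-≤ (length ub) shorter) bound)
      finish : Dec (ℓ (v ++ [ s ]) ℕ.< ℓ v) → Dec (ℓ (v ++ [ s′ ]) ℕ.< ℓ v) → Descent
      finish (yes shorter) _             = peel false shorter
      finish (no _)        (yes shorter) = peel true shorter
      finish (no ¬shorter) (no ¬shorter′) = record
        { v = v ; ub = ub ; v·ub≈w = v·ub≈w ; length-bound = bound ; ub-nonempty = nonempty
        ; ascent-s = ℕP.≮⇒≥ ¬shorter ; ascent-s′ = ℕP.≮⇒≥ ¬shorter′ }

module _ {r : ℕ} {A : Matrix r} (cartan : IsIrreducibleCartan A) where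
  open IsIrreducibleCartan cartan using (diag)
  open Words A

  private
    length-∷ʳ : ∀ (R : List (Fin r)) s → length (R ∷ʳ s) ≡ suc (length R)
    length-∷ʳ R s = trans (List.length-++ R) (ℕP.+-comm (length R) 1)

  reduced-last≢ascent : ∀ {w R₁ s s′} → reduced w ≡ R₁ ∷ʳ s′ → ℓ w ℕ.≤ ℓ (w ++ [ s ]) → s ≢ s′
  reduced-last≢ascent {w} {R₁} {s} R≡ ascent refl = ℕP.<⇒≱ (begin-strict
    ℓ (w ++ [ s ])                  ≡⟨ ℓ-resp-≈ (++-congʳ [ s ] (≈-sym (subst (_≈ w) R≡ (reduced-≈ w)))) ⟩
    ℓ ((R₁ ++ [ s ]) ++ [ s ])      ≡⟨ ℓ-resp-≈ (cancelʳ {A = A} diag R₁ s) ⟩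
    ℓ R₁                            ≤⟨ ℓ≤length R₁ ⟩
    length R₁                       <⟨ ℕP.n<1+n (length R₁) ⟩
    suc (length R₁)                 ≡⟨ trans (cong length R≡) (length-∷ʳ R₁ s) ⟨
    ℓ w                             ∎) ascent
    where open ℕP.≤-Reasoning

  module _ {w s s′} (ascent : ℓ w ℕ.≤ ℓ (w ++ [ s ])) (d : Descent {A = A} diag w s s′) where
    open Descent d
    open Parabolic₂ A diag s s′ using (word; NoShortcut)

    descent-noShortcut : NoShortcut ub
    descent-noShortcut vb vb≈ub·s with length ub ℕ.≤? length vb
    ... | yes |ub|≤|vb| = |ub|≤|vb|
    ... | no  |ub|≰|vb| = contradiction ascent (ℕP.<⇒≱ (begin-strict
      ℓ (w ++ [ s ])                 ≡⟨ ℓ-resp-≈ w·s≈v·vb ⟩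
      ℓ (v ++ word vb)               ≤⟨ ℓ-++ v (word vb) ⟩
      ℓ v ℕ.+ length (word vb)       ≡⟨ cong (ℓ v ℕ.+_) (List.length-map _ vb) ⟩
      ℓ v ℕ.+ length vb              <⟨ ℕP.+-monoʳ-< (ℓ v) (ℕP.≰⇒> |ub|≰|vb|) ⟩
      ℓ v ℕ.+ length ub              ≤⟨ length-bound ⟩
      ℓ w                            ∎))
      where
      open ℕP.≤-Reasoning
      w·s≈v·vb : w ++ [ s ] ≈ v ++ word vb
      w·s≈v·vb = ≈-trans (++-congʳ [ s ] (≈-sym v·ub≈w))
        (subst (_≈ v ++ word vb) (trans (cong (v ++_) (List.map-++ _ ub [ false ])) (sym (List.++-assoc v (word ub) [ s ])))
               (++-congˡ v (≈-sym vb≈ub·s)))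

  nonNegative-ascent : ∀ w s → Acc ℕ._<_ (ℓ w) → ℓ w ℕ.≤ ℓ (w ++ [ s ]) → NonNegative (actRoot A w (unit s))
  nonNegative-ascent w s (acc rs) ascent = from-last (reduced w) refl (initLast (reduced w))
    where
    from-last : ∀ R → reduced w ≡ R → InitLast R → NonNegative (actRoot A w (unit s))
    from-last .[] R≡ [] k =
      subst (0ℤ ≤_) (≈⇒actRoot-≗ (subst (_≈ w) R≡ (reduced-≈ w)) (unit s) k) (unit-nonneg s k)
    from-last .(R₁ ∷ʳ s′) R≡ (R₁ ∷ʳ′ s′) k =
      subst (0ℤ ≤_) (sym decompose) (ℤP.+-mono-≤ (0≤*-nonNeg 0≤x (IH-s k)) (0≤*-nonNeg 0≤y (IH-s′ k)))
      where
      open Parabolic₂ A diag s s′ using (word; noShortcut-nonNegative)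
      start : ℓ R₁ ℕ.+ 1 ℕ.≤ ℓ w
      start = ℕP.≤-trans (ℕP.+-monoˡ-≤ 1 (ℓ≤length R₁))
                         (ℕP.≤-reflexive (sym (trans (cong length R≡) (List.length-++ R₁))))
      d : Descent {A = A} diag w s s′
      d = descend {A = A} diag w s s′ R₁ [ true ] (<-wellFounded (ℓ R₁)) (subst (_≈ w) R≡ (reduced-≈ w)) start (s≤s z≤n)
      open Descent d
      open NonNegativeCombination (noShortcut-nonNegative (finiteType₂-cartan cartan (reduced-last≢ascent {w} R≡ ascent)) ub
                                                          (descent-noShortcut ascent d))
      v<w : ℓ v ℕ.< ℓ w
      v<w = ℕP.<-≤-trans (ℕP.m<m+n (ℓ v) ub-nonempty) length-bound
      IH-s = nonNegative-ascent v s (rs v<w) ascent-s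
      IH-s′ = nonNegative-ascent v s′ (rs v<w) ascent-s′
      decompose : actRoot A w (unit s) k ≡ x * actRoot A v (unit s) k + y * actRoot A v (unit s′) k
      decompose = begin
        actRoot A w (unit s) k                                 ≡⟨ ≈⇒actRoot-≗ (≈-sym v·ub≈w) (unit s) k ⟩
        actRoot A (v ++ word ub) (unit s) k                    ≡⟨ cong (λ β → β k) (actRoot-++ A v (word ub) (unit s)) ⟩
        actRoot A v (actRoot A (word ub) (unit s)) k          ≡⟨ actRoot-cong A v δ≗ k ⟩
        actRoot A v (λ j → x * unit s j + y * unit s′ j) k     ≡⟨ +-hom (λ j → x * unit s j) (λ j → y * unit s′ j) ⟩
        actRoot A v (λ j → x * unit s j) k + actRoot A v (λ j → y * unit s′ j) k
          ≡⟨ cong₂ _+_ (*-hom x (unit s)) (*-hom y (unit s′)) ⟩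
        x * actRoot A v (unit s) k + y * actRoot A v (unit s′) k ∎
        where
        open ≡-Reasoning
        open IsLinear (actRoot-linear A v k)

  simpleRoot-image-sign : ∀ w s → NonNegative (actRoot A w (unit s)) ⊎ NonPositive (actRoot A w (unit s))
  simpleRoot-image-sign w s with ℓ w ℕ.≤? ℓ (w ++ [ s ])
  ... | yes ascent = inj₁ (nonNegative-ascent w s (<-wellFounded (ℓ w)) ascent)
  ... | no  descent = inj₂ λ k → ℤP.neg-cancel-≤ (subst (0ℤ ≤_) (flip k) (nonNegative-ascent (w ++ [ s ]) s (<-wellFounded (ℓ (w ++ [ s ]))) ascent′ k))
    where
    ascent′ : ℓ (w ++ [ s ]) ℕ.≤ ℓ ((w ++ [ s ]) ++ [ s ])
    ascent′ = ℕP.≤-trans (ℕP.<⇒≤ (ℕP.≰⇒> descent)) (ℕP.≤-reflexive (sym (ℓ-resp-≈ (cancelʳ {A = A} diag w s))))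
    flip : ∀ k → actRoot A (w ++ [ s ]) (unit s) k ≡ - actRoot A w (unit s) k
    flip k = begin
      actRoot A (w ++ [ s ]) (unit s) k        ≡⟨ cong (λ β → β k) (actRoot-++ A w [ s ] (unit s)) ⟩
      actRoot A w (sRoot A s (unit s)) k       ≡⟨ actRoot-cong A w (sRoot-unit A diag s) k ⟩
      actRoot A w (negV (unit s)) k            ≡⟨ linear-neg (actRoot-linear A w k) (unit s) ⟩
      - actRoot A w (unit s) k                 ∎
      where open ≡-Reasoning

-- Heights of roots

height : ∀ {r} → Vecℤ r → ℤ
height = sumℤ

module _ {r : ℕ} {A : Matrix r} (cartan : IsIrreducibleCartan A) where
  open IsIrreducibleCartan cartan using (diag)

  root-resp : ∀ {β γ} → IsRoot A β → β ≗ γ → IsRoot A γ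
  root-resp (w , i , wαᵢ≗β) β≗γ = w , i , λ k → trans (wαᵢ≗β k) (β≗γ k)

  root-unit : ∀ i → IsRoot A (unit i)
  root-unit i = [] , i , λ k → refl

  root-actRoot : ∀ {β} w → IsRoot A β → IsRoot A (actRoot A w β)
  root-actRoot w (u , i , uαᵢ≗β) = w ++ u , i , λ k →
    trans (cong (λ γ → γ k) (actRoot-++ A w u (unit i))) (actRoot-cong A w uαᵢ≗β k)

  root-neg : ∀ {β} → IsRoot A β → IsRoot A (negV β)
  root-neg {β} (u , i , uαᵢ≗β) = u ++ [ i ] , i , λ k → begin
    actRoot A (u ++ [ i ]) (unit i) k      ≡⟨ cong (λ γ → γ k) (actRoot-++ A u [ i ] (unit i)) ⟩
    actRoot A u (sRoot A i (unit i)) k     ≡⟨ actRoot-cong A u (sRoot-unit A diag i) k ⟩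
    actRoot A u (negV (unit i)) k          ≡⟨ linear-neg (actRoot-linear A u k) (unit i) ⟩
    - actRoot A u (unit i) k               ≡⟨ cong -_ (uαᵢ≗β k) ⟩
    - β k                                  ∎
    where open ≡-Reasoning

  root-sign : ∀ {β} → IsRoot A β → NonNegative β ⊎ NonPositive β
  root-sign (w , i , wαᵢ≗β) with simpleRoot-image-sign cartan w i
  ... | inj₁ nonNeg = inj₁ λ k → subst (0ℤ ≤_) (wαᵢ≗β k) (nonNeg k)
  ... | inj₂ nonPos = inj₂ λ k → subst (_≤ 0ℤ) (wαᵢ≗β k) (nonPos k)

  root-nonzero : ∀ {β} → IsRoot A β → ¬ (∀ k → β k ≡ 0ℤ)
  root-nonzero {β} (w , i , wαᵢ≗β) β≡0 = contradiction (begin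
    1ℤ                                                   ≡⟨ unit-diag i ⟨
    unit i i                                             ≡⟨ actRoot-reverseˡ A diag w (unit i) i ⟨
    actRoot A (reverse w) (actRoot A w (unit i)) i       ≡⟨ actRoot-cong A (reverse w) (λ k → trans (wαᵢ≗β k) (β≡0 k)) i ⟩
    actRoot A (reverse w) (λ _ → 0ℤ) i                   ≡⟨ linear-zero (actRoot-linear A (reverse w) i) ⟩
    0ℤ                                                   ∎) λ ()
    where open ≡-Reasoning

  height-nonNeg : ∀ {β} → IsRoot A β → NonNegative β → 0ℤ < height β
  height-nonNeg {β} β-root 0≤β with nonzero-coordinate (root-nonzero β-root)
  ... | k , βk≢0 = subst (_< height β) (sumℤ-zero r) (sumℤ-mono-< 0≤β k (ℤP.≤∧≢⇒< (0≤β k) (βk≢0 ∘ sym)))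

  height-nonPos : ∀ {β} → IsRoot A β → NonPositive β → height β < 0ℤ
  height-nonPos {β} β-root β≤0 = ℤP.neg-cancel-<
    (subst (0ℤ <_) (sumℤ-neg β) (height-nonNeg (root-neg β-root) (λ k → ℤP.neg-mono-≤ (β≤0 k))))

  height≢0 : ∀ {β} → IsRoot A β → height β ≢ 0ℤ
  height≢0 β-root with root-sign β-root
  ... | inj₁ 0≤β = ℤP.<⇒≢ (height-nonNeg β-root 0≤β) ∘ sym
  ... | inj₂ β≤0 = ℤP.<⇒≢ (height-nonPos β-root β≤0)

  module Highest {θ : Vecℤ r} (highest : IsHighestRoot A θ) where

    θ-dominates : ∀ {β} → IsRoot A β → ∀ k → β k ≤ θ k
    θ-dominates {β} = proj₂ highest β

    θ-nonNeg : NonNegative θ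
    θ-nonNeg k = ℤP.≤-trans (ℤ.+≤+ ℕ.z≤n) (subst (_≤ θ k) (unit-diag k) (θ-dominates (root-unit k) k))

    0≤height-θ : 0ℤ ≤ height θ
    0≤height-θ = subst (_≤ height θ) (sumℤ-zero r) (sumℤ-mono-≤ θ-nonNeg)

    height≤height-θ : ∀ {β} → IsRoot A β → height β ≤ height θ
    height≤height-θ β-root = sumℤ-mono-≤ (θ-dominates β-root)

    open Residues (height θ) 0≤height-θ public

    root-height-range : ∀ {β} → IsRoot A β → InRange (height β)
    root-height-range {β} β-root =
      subst (- height θ ≤_) (ℤP.neg-involutive (height β))
            (ℤP.neg-mono-≤ (subst (_≤ height θ) (sumℤ-neg β) (height≤height-θ (root-neg β-root))))
      , height≤height-θ β-root , height≢0 β-root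

    height≡height-θ⇒θ : ∀ {β} → IsRoot A β → height β ≡ height θ → β ≗ θ
    height≡height-θ⇒θ β-root = sumℤ-≤∧≡⇒≗ (θ-dominates β-root)

    negInd-χ<0 : ∀ w α → IsRoot A (actRoot A w α) → negInd A θ w α ≡ χ<0 (height (actRoot A w α))
    negInd-χ<0 w α wα-root with all? (λ k → actRoot A w α k ℤ.≤? 0ℤ)
    ... | yes wα≤0 = sym (χ<0-neg (height-nonPos wα-root wα≤0))
    ... | no  wα≰0 with root-sign wα-root
    ...   | inj₁ 0≤wα = sym (χ<0-nonNeg (ℤP.<⇒≤ (height-nonNeg wα-root 0≤wα)))
    ...   | inj₂ wα≤0 = contradiction wα≤0 wα≰0

-- Invariance under C

module _ {r : ℕ} {A : Matrix r} (cartan : IsIrreducibleCartan A) {θ : Vecℤ r} (highest : IsHighestRoot A θ) where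
  open IsIrreducibleCartan cartan using (diag)
  open Highest cartan highest

  affineRoot : Fin (suc r) → Vecℤ r
  affineRoot zero    = negV θ
  affineRoot (suc i) = unit i

  mark : Fin (suc r) → ℤ
  mark zero    = 1ℤ
  mark (suc i) = θ i

  affineRoot-root : ∀ i → IsRoot A (affineRoot i)
  affineRoot-root zero    = root-neg cartan (proj₁ highest)
  affineRoot-root (suc i) = root-unit cartan i

  cdes-affine : ∀ w → cdes A θ w ≡ sumℤ (λ i → mark i * negInd A θ w (affineRoot i))
  cdes-affine w = cong (_+ sumℤ (λ i → θ i * dᵢ A θ w i)) (sym (ℤP.*-identityˡ (d₀ A θ w)))

  affine-relation : ∀ k → sumℤ (λ i → mark i * affineRoot i k) ≡ 0ℤ
  affine-relation k = begin
    1ℤ * - θ k + sumℤ (λ j → θ j * unit j k)   ≡⟨ cong₂ _+_ (ℤP.*-identityˡ (- θ k)) (sumℤ-cong (λ j → ℤP.*-comm (θ j) (unit j k))) ⟩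
    - θ k + sumℤ (λ j → unit j k * θ j)         ≡⟨ cong (_+_ (- θ k)) (unit*-sumℤ θ k) ⟩
    - θ k + θ k                                 ≡⟨ ℤP.+-inverseˡ (θ k) ⟩
    0ℤ                                          ∎
    where open ≡-Reasoning

  linear-affine-relation : ∀ {f : Vecℤ r → ℤ} → IsLinear f → sumℤ (λ i → mark i * f (affineRoot i)) ≡ 0ℤ
  linear-affine-relation {f} f-linear = begin
    sumℤ (λ i → mark i * f (affineRoot i))           ≡⟨ linear-combination f-linear mark affineRoot ⟨
    f (λ k → sumℤ (λ i → mark i * affineRoot i k))   ≡⟨ IsLinear.resp-≗ f-linear affine-relation ⟩
    f (λ _ → 0ℤ)                                     ≡⟨ linear-zero f-linear ⟩
    0ℤ                                               ∎
    where open ≡-Reasoning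

  affine-relation-unique : ∀ (b : Fin (suc r) → ℤ) → (∀ k → sumℤ (λ i → b i * affineRoot i k) ≡ 0ℤ) →
                           sumℤ b ≡ h → ∀ i → b i ≡ mark i
  affine-relation-unique b relation Σb≡h = b≡mark
    where
    b-suc : ∀ k → b (suc k) ≡ b zero * θ k
    b-suc k = begin
      b (suc k)                                    ≡⟨ unit*-sumℤ (b ∘ suc) k ⟨
      sumℤ (λ j → unit j k * b (suc j))            ≡⟨ sumℤ-cong (λ j → ℤP.*-comm (unit j k) (b (suc j))) ⟩
      sumℤ (λ j → b (suc j) * unit j k)            ≡⟨ isolate (b zero) (θ k) _ ⟩
      b zero * - θ k + sumℤ (λ j → b (suc j) * unit j k) + b zero * θ k  ≡⟨ cong (_+ b zero * θ k) (relation k) ⟩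
      0ℤ + b zero * θ k                            ≡⟨ ℤP.+-identityˡ _ ⟩
      b zero * θ k                                 ∎
      where
      open ≡-Reasoning
      isolate : ∀ b₀ t s → s ≡ b₀ * - t + s + b₀ * t
      isolate = solve-∀
    b₀h≡h : b zero * h ≡ 1ℤ * h
    b₀h≡h = begin
      b zero * h                        ≡⟨ factor (b zero) (sumℤ θ) ⟩
      b zero + b zero * sumℤ θ          ≡⟨ cong (_+_ (b zero)) (trans (sumℤ-cong b-suc) (*-distribˡ-sumℤ (b zero) θ)) ⟨
      sumℤ b                            ≡⟨ Σb≡h ⟩
      h                                 ≡⟨ ℤP.*-identityˡ h ⟨
      1ℤ * h                            ∎
      where
      open ≡-Reasoning
      factor : ∀ b₀ s → b₀ * (1ℤ + s) ≡ b₀ + b₀ * s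
      factor = solve-∀
    b₀≡1 : b zero ≡ 1ℤ
    b₀≡1 = ℤP.*-cancelʳ-≡ (b zero) 1ℤ h {{ℤ.≢-nonZero (ℤP.<⇒≢ 0<h ∘ sym)}} b₀h≡h
    b≡mark : ∀ i → b i ≡ mark i
    b≡mark zero    = b₀≡1
    b≡mark (suc k) = trans (b-suc k) (trans (cong (_* θ k) b₀≡1) (ℤP.*-identityˡ (θ k)))

  private
    neg-nonNeg≢1 : ∀ {z} → 0ℤ ≤ z → - z ≢ 1ℤ
    neg-nonNeg≢1 {+ zero}     _ ()
    neg-nonNeg≢1 {ℤ.+[1+ n ]} _ ()

  affineRoot-injective : ∀ {i j} → affineRoot i ≗ affineRoot j → i ≡ j
  affineRoot-injective {zero}  {zero}  _ = refl
  affineRoot-injective {zero}  {suc j} eq = ⊥-elim (neg-nonNeg≢1 (θ-nonNeg j) (trans (eq j) (unit-diag j)))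
  affineRoot-injective {suc i} {zero}  eq = ⊥-elim (neg-nonNeg≢1 (θ-nonNeg i) (trans (sym (eq i)) (unit-diag i)))
  affineRoot-injective {suc i} {suc j} eq with i Fin.≟ j
  ... | yes i≡j = cong suc i≡j
  ... | no  i≢j = contradiction (trans (sym (unit-diag i)) (trans (eq i) (unit-offdiag (i≢j ∘ sym)))) λ ()

  module _ (c : List (Fin r)) (c∈C : InC A θ c) where

    private
      h∣cρ-ρ : ∀ k → h ∣ (actCoweight A c (ρ A θ) k - 1ℤ)
      h∣cρ-ρ k = ∣ᵤ⇒∣ {h} {actCoweight A c (ρ A θ) k - 1ℤ} (c∈C k)

    λᶜ : Vecℤ r
    λᶜ k = quotient (h∣cρ-ρ k)

    ρ-image : ∀ k → actCoweight A c (ρ A θ) k ≡ 1ℤ + h * λᶜ k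
    ρ-image k = trans (add-one (actCoweight A c (ρ A θ) k))
                      (cong (_+_ 1ℤ) (trans (_∣_.equality (h∣cρ-ρ k)) (ℤP.*-comm (λᶜ k) h)))
      where
      add-one : ∀ a → a ≡ 1ℤ + (a - 1ℤ)
      add-one = solve-∀

    height-actRoot : ∀ γ → height (actRoot A c γ) ≡ height γ - h * pairing λᶜ (actRoot A c γ)
    height-actRoot γ = move (height γ) (height cγ) (h * pairing λᶜ cγ) (begin
      height γ                                               ≡⟨ sumℤ-cong (λ k → ℤP.*-identityˡ (γ k)) ⟨
      pairing (ρ A θ) γ                                      ≡⟨ pairing-invariant A diag c (ρ A θ) γ ⟨
      pairing (actCoweight A c (ρ A θ)) cγ                   ≡⟨ sumℤ-cong (λ k → trans (cong (_* cγ k) (ρ-image k)) (expand (λᶜ k) (cγ k) h)) ⟩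
      sumℤ (λ k → cγ k + h * (λᶜ k * cγ k))                  ≡⟨ sumℤ-distrib-+ cγ (λ k → h * (λᶜ k * cγ k)) ⟩
      height cγ + sumℤ (λ k → h * (λᶜ k * cγ k))             ≡⟨ cong (_+_ (height cγ)) (*-distribˡ-sumℤ h (λ k → λᶜ k * cγ k)) ⟩
      height cγ + h * pairing λᶜ cγ                          ∎)
      where
      open ≡-Reasoning
      cγ = actRoot A c γ
      expand : ∀ l x h → (1ℤ + h * l) * x ≡ x + h * (l * x)
      expand = solve-∀
      move : ∀ a b d → a ≡ b + d → b ≡ a - d
      move a b d a≡b+d = trans (cancel b d) (cong (_- d) (sym a≡b+d))
        where
        cancel : ∀ b d → b ≡ b + d - d
        cancel = solve-∀

    shift : List (Fin r) → Vecℤ r → ℤ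
    shift x α = pairing λᶜ (actRoot A c (actRoot A x α))

    shift-linear : ∀ x → IsLinear (shift x)
    shift-linear x = linear-resp (λ α → cong (pairing λᶜ) (actRoot-++ A c x α))
                                 (combination-linear λᶜ (actRoot-linear A (c ++ x)))

    negInd-left : ∀ x α → IsRoot A α → negInd A θ (c ++ x) α ≡ negInd A θ x α + shift x α
    negInd-left x α α-root = begin
      negInd A θ (c ++ x) α                    ≡⟨ negInd-χ<0 (c ++ x) α (root-resp cartan cxα-root cxα≡) ⟩
      χ<0 (height (actRoot A (c ++ x) α))      ≡⟨ cong (χ<0 ∘ height) (actRoot-++ A c x α) ⟩
      χ<0 (height (actRoot A c xα))            ≡⟨ cong χ<0 (height-actRoot xα) ⟩
      χ<0 (height xα - h * shift x α)          ≡⟨ χ<0-shift (shift x α) (root-height-range xα-root)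
                                                    (subst InRange (height-actRoot xα) (root-height-range cxα-root)) ⟩
      χ<0 (height xα) + shift x α              ≡⟨ cong (_+ shift x α) (negInd-χ<0 x α xα-root) ⟨
      negInd A θ x α + shift x α               ∎
      where
      open ≡-Reasoning
      xα = actRoot A x α
      xα-root = root-actRoot cartan x α-root
      cxα-root = root-actRoot cartan c xα-root
      cxα≡ : actRoot A c xα ≗ actRoot A (c ++ x) α
      cxα≡ k = cong (λ β → β k) (sym (actRoot-++ A c x α))

    cdes-leftInvariant : ∀ x → cdes A θ (c ++ x) ≡ cdes A θ x
    cdes-leftInvariant x = begin
      cdes A θ (c ++ x)
        ≡⟨ cdes-affine (c ++ x) ⟩
      sumℤ (λ i → mark i * negInd A θ (c ++ x) (affineRoot i))
        ≡⟨ sumℤ-cong (λ i → trans (cong (mark i *_) (negInd-left x (affineRoot i) (affineRoot-root i)))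
                                  (ℤP.*-distribˡ-+ (mark i) (negInd A θ x (affineRoot i)) (shift x (affineRoot i)))) ⟩
      sumℤ (λ i → mark i * negInd A θ x (affineRoot i) + mark i * shift x (affineRoot i))
        ≡⟨ sumℤ-distrib-+ (λ i → mark i * negInd A θ x (affineRoot i)) (λ i → mark i * shift x (affineRoot i)) ⟩
      sumℤ (λ i → mark i * negInd A θ x (affineRoot i)) + sumℤ (λ i → mark i * shift x (affineRoot i))
        ≡⟨ cong₂ _+_ (sym (cdes-affine x)) (linear-affine-relation (shift-linear x)) ⟩
      cdes A θ x + 0ℤ
        ≡⟨ ℤP.+-identityʳ (cdes A θ x) ⟩
      cdes A θ x ∎
      where open ≡-Reasoning

    reverse∈C : InC A θ (reverse c)
    reverse∈C k = ∣⇒∣ᵤ (divides (- actCoweight A (reverse c) λᶜ k) (begin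
      c⁻¹ρ - 1ℤ                                              ≡⟨ cong (_-_ c⁻¹ρ) ρ-decomposition ⟩
      c⁻¹ρ - (c⁻¹ρ + h * actCoweight A (reverse c) λᶜ k)     ≡⟨ cancel c⁻¹ρ (actCoweight A (reverse c) λᶜ k) h ⟩
      - actCoweight A (reverse c) λᶜ k * h                   ∎))
      where
      open ≡-Reasoning
      open IsLinear (actCoweight-linear A (reverse c) k)
      c⁻¹ρ = actCoweight A (reverse c) (ρ A θ) k
      ρ-decomposition : 1ℤ ≡ c⁻¹ρ + h * actCoweight A (reverse c) λᶜ k
      ρ-decomposition = begin
        1ℤ                                                                   ≡⟨ actCoweight-reverseˡ A diag c (ρ A θ) k ⟨
        actCoweight A (reverse c) (actCoweight A c (ρ A θ)) k                ≡⟨ resp-≗ ρ-image ⟩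
        actCoweight A (reverse c) (λ j → 1ℤ + h * λᶜ j) k                    ≡⟨ +-hom (ρ A θ) (λ j → h * λᶜ j) ⟩
        c⁻¹ρ + actCoweight A (reverse c) (λ j → h * λᶜ j) k                  ≡⟨ cong (_+_ c⁻¹ρ) (*-hom h λᶜ) ⟩
        c⁻¹ρ + h * actCoweight A (reverse c) λᶜ k                            ∎
      cancel : ∀ a l h → a - (a + h * l) ≡ - l * h
      cancel = solve-∀

    private
      level : Fin (suc r) → ℤ
      level zero    = 1ℤ
      level (suc _) = 0ℤ

      height-affineRoot : ∀ i → height (affineRoot i) ≡ 1ℤ - h * level i
      height-affineRoot zero    = trans (sumℤ-neg θ) (minus-S (height θ))
        where
        minus-S : ∀ S → - S ≡ 1ℤ - (1ℤ + S) * 1ℤ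
        minus-S = solve-∀
      height-affineRoot (suc j) = trans (sumℤ-unit j) (one h)
        where
        one : ∀ h → 1ℤ ≡ 1ℤ - h * 0ℤ
        one = solve-∀

    affine-image : ∀ i → Σ[ j ∈ Fin (suc r) ] actRoot A c (affineRoot i) ≗ affineRoot j
    affine-image i = by-height (≡1-mod-h (level i + pairing λᶜ γ) (root-height-range γ-root) height-γ)
      where
      γ = actRoot A c (affineRoot i)
      γ-root = root-actRoot cartan c (affineRoot-root i)
      height-γ : height γ ≡ 1ℤ - h * (level i + pairing λᶜ γ)
      height-γ = trans (height-actRoot (affineRoot i))
        (trans (cong (_- h * pairing λᶜ γ) (height-affineRoot i)) (collect h (level i) (pairing λᶜ γ)))
        where
        collect : ∀ h l m → 1ℤ - h * l - h * m ≡ 1ℤ - h * (l + m)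
        collect = solve-∀
      by-height : height γ ≡ 1ℤ ⊎ height γ ≡ - height θ → Σ[ j ∈ Fin (suc r) ] γ ≗ affineRoot j
      by-height (inj₁ height≡1) with root-sign cartan γ-root
      ... | inj₁ 0≤γ = suc (proj₁ (nonneg∧sumℤ≡1⇒unit 0≤γ height≡1)) , proj₂ (nonneg∧sumℤ≡1⇒unit 0≤γ height≡1)
      ... | inj₂ γ≤0 = contradiction (subst (_< 0ℤ) height≡1 (height-nonPos cartan γ-root γ≤0)) λ { (ℤ.+<+ ()) }
      by-height (inj₂ height≡-S) = zero , λ k → trans (sym (ℤP.neg-involutive (γ k))) (cong -_ (-γ≗θ k))
        where
        -γ≗θ : negV γ ≗ θ
        -γ≗θ = height≡height-θ⇒θ (root-neg cartan γ-root)
                 (trans (sumℤ-neg γ) (trans (cong -_ height≡-S) (ℤP.neg-involutive (height θ))))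

    opaque
      affinePermutation : Fin (suc r) → Fin (suc r)
      affinePermutation i = proj₁ (affine-image i)

      affinePermutation-spec : ∀ i → actRoot A c (affineRoot i) ≗ affineRoot (affinePermutation i)
      affinePermutation-spec i = proj₂ (affine-image i)

  module _ (c : List (Fin r)) (c∈C : InC A θ c) where

    private
      σ σ⁻¹ : Fin (suc r) → Fin (suc r)
      σ   = affinePermutation c c∈C
      σ⁻¹ = affinePermutation (reverse c) (reverse∈C c c∈C)

      σ⁻¹∘σ : ∀ i → σ⁻¹ (σ i) ≡ i
      σ⁻¹∘σ i = affineRoot-injective {σ⁻¹ (σ i)} {i} λ k → begin
        affineRoot (σ⁻¹ (σ i)) k                                  ≡⟨ affinePermutation-spec (reverse c) (reverse∈C c c∈C) (σ i) k ⟨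
        actRoot A (reverse c) (affineRoot (σ i)) k                ≡⟨ actRoot-cong A (reverse c) (sym ∘ affinePermutation-spec c c∈C i) k ⟩
        actRoot A (reverse c) (actRoot A c (affineRoot i)) k      ≡⟨ actRoot-reverseˡ A diag c (affineRoot i) k ⟩
        affineRoot i k                                            ∎
        where open ≡-Reasoning

      σ∘σ⁻¹ : ∀ j → σ (σ⁻¹ j) ≡ j
      σ∘σ⁻¹ j = affineRoot-injective {σ (σ⁻¹ j)} {j} λ k → begin
        affineRoot (σ (σ⁻¹ j)) k                                  ≡⟨ affinePermutation-spec c c∈C (σ⁻¹ j) k ⟨
        actRoot A c (affineRoot (σ⁻¹ j)) k                        ≡⟨ actRoot-cong A c (sym ∘ affinePermutation-spec (reverse c) (reverse∈C c c∈C) j) k ⟩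
        actRoot A c (actRoot A (reverse c) (affineRoot j)) k      ≡⟨ actRoot-reverseʳ A diag c (affineRoot j) k ⟩
        affineRoot j k                                            ∎
        where open ≡-Reasoning


    mark-invariant : ∀ i → mark (σ i) ≡ mark i
    mark-invariant i = trans (sym (mark∘σ⁻¹≗mark (σ i))) (cong mark (σ⁻¹∘σ i))
      where
      relation : ∀ k → sumℤ (λ j → mark (σ⁻¹ j) * affineRoot j k) ≡ 0ℤ
      relation k = begin
        sumℤ (λ j → mark (σ⁻¹ j) * affineRoot j k)                 ≡⟨ sumℤ-permute σ σ⁻¹ σ∘σ⁻¹ σ⁻¹∘σ (λ j → mark (σ⁻¹ j) * affineRoot j k) ⟨
        sumℤ (λ i → mark (σ⁻¹ (σ i)) * affineRoot (σ i) k)         ≡⟨ sumℤ-cong (λ i → cong₂ _*_ (cong mark (σ⁻¹∘σ i))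
                                                                            (sym (affinePermutation-spec c c∈C i k))) ⟩
        sumℤ (λ i → mark i * actRoot A c (affineRoot i) k)         ≡⟨ linear-affine-relation (actRoot-linear A c k) ⟩
        0ℤ                                                         ∎
        where open ≡-Reasoning
      mark∘σ⁻¹≗mark : ∀ j → mark (σ⁻¹ j) ≡ mark j
      mark∘σ⁻¹≗mark = affine-relation-unique (mark ∘ σ⁻¹) relation (sumℤ-permute σ⁻¹ σ σ⁻¹∘σ σ∘σ⁻¹ mark)

    cdes-rightInvariant : ∀ x → cdes A θ (x ++ c) ≡ cdes A θ x
    cdes-rightInvariant x = begin
      cdes A θ (x ++ c)                                            ≡⟨ cdes-affine (x ++ c) ⟩
      sumℤ (λ i → mark i * negInd A θ (x ++ c) (affineRoot i))     ≡⟨ sumℤ-cong (λ i → cong₂ _*_ (sym (mark-invariant i)) (negInd-right i)) ⟩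
      sumℤ (λ i → mark (σ i) * negInd A θ x (affineRoot (σ i)))    ≡⟨ sumℤ-permute σ σ⁻¹ σ∘σ⁻¹ σ⁻¹∘σ (λ j → mark j * negInd A θ x (affineRoot j)) ⟩
      sumℤ (λ j → mark j * negInd A θ x (affineRoot j))            ≡⟨ cdes-affine x ⟨
      cdes A θ x                                                   ∎
      where
      open ≡-Reasoning
      negInd-right : ∀ i → negInd A θ (x ++ c) (affineRoot i) ≡ negInd A θ x (affineRoot (σ i))
      negInd-right i = begin
        negInd A θ (x ++ c) (affineRoot i)               ≡⟨ negInd-χ<0 (x ++ c) (affineRoot i) (root-resp cartan xσα-root (sym ∘ moved)) ⟩
        χ<0 (height (actRoot A (x ++ c) (affineRoot i))) ≡⟨ cong χ<0 (sumℤ-cong moved) ⟩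
        χ<0 (height (actRoot A x (affineRoot (σ i))))    ≡⟨ negInd-χ<0 x (affineRoot (σ i)) xσα-root ⟨
        negInd A θ x (affineRoot (σ i))                  ∎
        where
        xσα-root = root-actRoot cartan x (affineRoot-root (σ i))
        moved : actRoot A (x ++ c) (affineRoot i) ≗ actRoot A x (affineRoot (σ i))
        moved k = trans (cong (λ β → β k) (actRoot-++ A x c (affineRoot i))) (actRoot-cong A x (affinePermutation-spec c c∈C i) k)

mainTheorem4 : ∀ {r : ℕ} (A : Matrix r) → IsIrreducibleCartan A →
    (θ : Vecℤ r) → IsHighestRoot A θ →
    ∀ (w c₁ c₂ : List (Fin r)) → InC A θ c₁ → InC A θ c₂ →
    cdes A θ (c₁ ++ w ++ c₂) ≡ cdes A θ w
mainTheorem4 A cartan θ highest w c₁ c₂ c₁∈C c₂∈C = begin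
  cdes A θ (c₁ ++ w ++ c₂)  ≡⟨ cdes-leftInvariant cartan highest c₁ c₁∈C (w ++ c₂) ⟩
  cdes A θ (w ++ c₂)        ≡⟨ cdes-rightInvariant cartan highest c₂ c₂∈C w ⟩
  cdes A θ w                ∎
  where open ≡-Reasoning
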